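{- Let $q$ be a prime power and $n\ge 1$. The group ${\rm PU}(2n,q^2)$ acts transitively on the Baer subgeometries of ${\rm PG}(2n-1,q^2)$ embedded in the non-degenerate Hermitian variety $\mathcal H(2n-1,q^2)$.
   Context: $\mathcal H(2n-1,q^2)$ is defined by a non-degenerate Hermitian form with Gram matrix $J$ ($J^q=J^t$); ${\rm U}(2n,q^2)=\{M\in{\rm GL}(2n,q^2):M^tJM^q=J\}$ and ${\rm PU}(2n,q^2)$ is the group of projectivities it induces. A Baer subgeometry is a subgeometry isomorphic to ${\rm PG}(2n-1,q)$; it is embedded in $\mathcal H(2n-1,q^2)$ if all its points lie on $\mathcal H(2n-1,q^2)$. -}

module Defs where

open import Level using (Level; _⊔_) renaming (suc to lsuc)
open import Data.Nat as ℕ using (ℕ; _≤_)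
open import Data.Nat.Primality using (Prime)
open import Data.Fin using (Fin)
import Data.Fin
import Relation.Nullary
open import Data.Product using (Σ; ∃; ∃₂; _×_)
open import Relation.Nullary using (¬_)
open import Relation.Binary.PropositionalEquality using (_≡_)
open import Relation.Unary using (Pred)
open import Algebra.Bundles using (CommutativeRing)
import Algebra.Bundles
import Algebra.Definitions.RawSemiring as RS

IsPrimePower : ℕ → Set
IsPrimePower q = ∃₂ λ p k → Prime p × 1 ≤ k × q ≡ p ℕ.^ k

module _ {c ℓ : Level} (R : CommutativeRing c ℓ) where
  open CommutativeRing R
  open RS (Algebra.Bundles.Semiring.rawSemiring semiring) using (sum; _^_)

  IsField : Set (c ⊔ ℓ)
  IsField = (¬ (1# ≈ 0#)) × (∀ x → ¬ (x ≈ 0#) → ∃ λ y → x * y ≈ 1#)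

  HasCardinality : ℕ → Set (c ⊔ ℓ)
  HasCardinality N = Σ (Fin N → Carrier) λ e →
    (∀ i j → e i ≈ e j → i ≡ j) × (∀ x → ∃ λ i → e i ≈ x)

  IsGF[q²] : ℕ → Set (c ⊔ ℓ)
  IsGF[q²] q = IsPrimePower q × IsField × HasCardinality (q ℕ.* q)

  Vec' : ℕ → Set c
  Vec' m = Fin m → Carrier

  Mat : ℕ → Set c
  Mat m = Fin m → Fin m → Carrier

  _≈ᵥ_ : ∀ {m} → Vec' m → Vec' m → Set ℓ
  x ≈ᵥ y = ∀ i → x i ≈ y i

  _≈ₘ_ : ∀ {m} → Mat m → Mat m → Set ℓ
  A ≈ₘ B = ∀ i j → A i j ≈ B i j

  NonZeroVec : ∀ {m} → Vec' m → Set ℓ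
  NonZeroVec x = ¬ (∀ i → x i ≈ 0#)

  _·ₘ_ : ∀ {m} → Mat m → Mat m → Mat m
  (A ·ₘ B) i j = sum λ k → A i k * B k j

  _·ᵥ_ : ∀ {m} → Mat m → Vec' m → Vec' m
  (A ·ᵥ x) i = sum λ k → A i k * x k

  transpose : ∀ {m} → Mat m → Mat m
  transpose A i j = A j i

  idMat : ∀ {m} → Mat m
  idMat {m} i j with i Data.Fin.≟ j
  ... | Relation.Nullary.yes _ = 1#
  ... | Relation.Nullary.no _ = 0#

  frobM : ℕ → ∀ {m} → Mat m → Mat m
  frobM q A i j = A i j ^ q

  frobV : ℕ → ∀ {m} → Vec' m → Vec' m
  frobV q x i = x i ^ q

  IsInvertible : ∀ {m} → Mat m → Set (c ⊔ ℓ)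
  IsInvertible {m} A = ∃ λ (B : Mat m) → ((A ·ₘ B) ≈ₘ idMat) × ((B ·ₘ A) ≈ₘ idMat)

  IsNondegHermitian : ℕ → ∀ {m} → Mat m → Set (c ⊔ ℓ)
  IsNondegHermitian q J = (frobM q J ≈ₘ transpose J) × IsInvertible J

  herm : ℕ → ∀ {m} → Mat m → Vec' m → Vec' m → Carrier
  herm q J x y = sum λ i → sum λ j → x i * J i j * (y j ^ q)

  IsUnitary : ℕ → ∀ {m} → Mat m → Mat m → Set (c ⊔ ℓ)
  IsUnitary q J M = IsInvertible M × ((transpose M ·ₘ J) ·ₘ frobM q M) ≈ₘ J

  -- A set of points of PG(m-1, q^2) is represented by a predicate on
  -- vectors (meant to be closed under nonzero scalars).
  PointSet : ℕ → Set (lsuc (c ⊔ ℓ))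
  PointSet m = Pred (Vec' m) (c ⊔ ℓ)

  -- The image of the canonical subgeometry PG(m-1,q) (points with all
  -- coordinates in GF(q) = {a : a^q = a}) under the projectivity induced by A:
  -- x lies in it iff x = λ · A v with λ ≠ 0, v ≠ 0, v ∈ GF(q)^m.
  canonicalBaerImage : ℕ → ∀ {m} → Mat m → PointSet m
  canonicalBaerImage q A x = ∃₂ λ (lam : Carrier) (v : Vec' _) →
    ¬ (lam ≈ 0#) × NonZeroVec v × (∀ i → v i ^ q ≈ v i) ×
    (x ≈ᵥ λ i → lam * (A ·ᵥ v) i)

  _≐_ : ∀ {m} → PointSet m → PointSet m → Set (c ⊔ ℓ)
  S ≐ T = ∀ x → (S x → T x) × (T x → S x)

  -- Baer subgeometry of PG(m-1,q^2): a subgeometry isomorphic to PG(m-1,q),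
  -- i.e. a projective image of the canonical one.
  IsBaerSubgeometry : ℕ → ∀ {m} → PointSet m → Set (c ⊔ ℓ)
  IsBaerSubgeometry q {m} S = ∃ λ (A : Mat m) → IsInvertible A × (S ≐ canonicalBaerImage q A)

  IsEmbeddedIn : ℕ → ∀ {m} → Mat m → PointSet m → Set (c ⊔ ℓ)
  IsEmbeddedIn q J S = ∀ x → S x → herm q J x x ≈ 0#

  imageUnder : ∀ {m} → Mat m → PointSet m → PointSet m
  imageUnder M S x = ∃ λ y → S y × (x ≈ᵥ (M ·ᵥ y))

-- A Baer subgeometry is the set of points λ·A v with v defined over GF(q), for an invertible frame A.
-- If it lies on the Hermitian variety of J, every point is isotropic, so the Hermitian Gram matrix
-- K = Aᵀ J A^q of the frame is alternating; as J^q = Jᵀ it also satisfies K^q = Kᵀ = -K. Dividing by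
-- a nonzero entry ε (for which ε^q = -ε) yields an invertible alternating matrix over GF(q), which a
-- symplectic basis over GF(q) brings to the standard form Ω. Changing the frames of the two
-- subgeometries by such GF(q)-matrices does not change the subgeometries and makes their Hermitian
-- Gram matrices equal; then M = A′ A⁻¹ preserves the form, i.e. is unitary, and maps one onto the other.
-- That x ↦ x^q is an involutive automorphism of GF(q²) comes from the freshman's dream in
-- characteristic p and Fermat's little theorem x^(q²) = x.

{-# OPTIONS --safe #-}
module Submission where

open import Level using (Level; _⊔_)
open import Function using (id; _∘_)
open import Data.Nat as ℕ using (ℕ; zero; suc; _<_; _∸_; _!; z≤n; s≤s)
import Data.Nat.Properties as ℕ
open import Data.Nat.Divisibility using (_∣_; _∤_; ∣⇒≤; ∣1⇒≡1; m∣m*n)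
open import Data.Nat.Primality using (Prime; euclidsLemma; ¬prime[0]; ¬prime[1])
open import Data.Nat.Combinatorics using (nCk≡n!/k![n-k]!; k![n∸k]!∣n!; nCn≡1) renaming (_C_ to _choose_)
open import Data.Nat.DivMod using (m/n*n≡m)
open import Data.Fin as Fin using (Fin; zero; suc; punchIn)
import Data.Fin.Properties as Fin
open import Data.Fin.Permutation using (Permutation′; permutation)
open import Data.Fin.Permutation.Components using (transpose-inverse) renaming (transpose to swap)
open import Data.Product using (∃; _×_; _,_; proj₁; proj₂)
open import Data.Sum using ([_,_])
open import Data.Empty using (⊥-elim)
open import Data.Maybe using (nothing)
open import Relation.Nullary using (¬_; Dec; yes; no)
open import Relation.Nullary.Decidable using (dec-true; dec-false)
open import Relation.Binary using (Setoid; Decidable)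
open import Relation.Binary.PropositionalEquality as ≡ using (_≡_; _≢_)
open import Algebra.Bundles using (CommutativeRing; CommutativeSemiring; CommutativeMonoid)
open import Algebra.Morphism.Structures using (module RingMorphisms)
import Algebra.Properties.Semiring.Sum as SemiringSum
import Algebra.Properties.CommutativeMonoid.Sum as MonoidSum
import Algebra.Properties.Ring as RingProperties
import Algebra.Properties.Monoid.Mult as MonoidMult
import Algebra.Properties.Semiring.Mult as SemiringMult
import Algebra.Properties.Semiring.Exp as SemiringExp
import Algebra.Properties.CommutativeSemiring.Exp as CommutativeSemiringExp
import Algebra.Properties.CommutativeSemiring.Binomial as Binomial
import Algebra.Solver.Ring.NaturalCoefficients as NaturalCoefficients
import Data.Vec.Functional.Relation.Binary.Equality.Setoid as PointwiseEquality
import Relation.Binary.Reasoning.Setoid as SetoidReasoning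
open import Defs

prime∤! : ∀ {p} → Prime p → ∀ {m} → m < p → p ∤ m !
prime∤! pp {zero} _ p∣1 = ¬prime[1] (≡.subst Prime (∣1⇒≡1 p∣1) pp)
prime∤! pp {suc m} m<p p∣m! =
  [ (λ p∣1+m → ℕ.<⇒≱ m<p (∣⇒≤ p∣1+m)) , prime∤! pp (ℕ.<-trans (ℕ.n<1+n m) m<p) ]
    (euclidsLemma (suc m) (m !) pp p∣m!)

prime∣binomial : ∀ {p k} → Prime p → 0 < k → k < p → p ∣ p choose k
prime∣binomial {zero} pp = ⊥-elim (¬prime[0] pp)
prime∣binomial {p@(suc p-1)} {k} pp 0<k k<p =
  [ id , ⊥-elim ∘ p∤factorials ] (euclidsLemma (p choose k) (k ! ℕ.* (p ∸ k) !) pp p∣binomial*factorials)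
  where
  k≤p : k ℕ.≤ p
  k≤p = ℕ.<⇒≤ k<p
  p∤factorials : p ∤ k ! ℕ.* (p ∸ k) !
  p∤factorials p∣ = [ prime∤! pp k<p , prime∤! pp (ℕ.∸-monoʳ-< 0<k k≤p) ] (euclidsLemma (k !) ((p ∸ k) !) pp p∣)
  binomial*factorials≡p! : (p choose k) ℕ.* (k ! ℕ.* (p ∸ k) !) ≡ p !
  binomial*factorials≡p! = ≡.trans (≡.cong (ℕ._* (k ! ℕ.* (p ∸ k) !)) (nCk≡n!/k![n-k]! k≤p))
                                   (m/n*n≡m {{k ℕ.!* (p ∸ k) !≢0}} (k![n∸k]!∣n! k≤p))
  p∣binomial*factorials : p ∣ (p choose k) ℕ.* (k ! ℕ.* (p ∸ k) !)
  p∣binomial*factorials = ≡.subst (p ∣_) (≡.sym binomial*factorials≡p!) (m∣m*n (p-1 !))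

module MatrixAlgebra {c ℓ : Level} (R : CommutativeRing c ℓ) where
  open CommutativeRing R hiding (zero)
  open RingProperties ring using (-0#≈0#; -‿+-comm; -‿distribˡ-*; -‿distribʳ-*)
  open SemiringSum semiring public
    using (sum; sum-cong-≋; ∑-comm; ∑-distrib-+; *-distribˡ-sum; *-distribʳ-sum; sum-replicate-zero)
  open NaturalCoefficients commutativeSemiring (λ _ _ → nothing) using (solve; _:=_; _:*_)

  sum-zero : ∀ {n} {f : Fin n → Carrier} → (∀ i → f i ≈ 0#) → sum f ≈ 0#
  sum-zero {n} f≈0 = trans (sum-cong-≋ f≈0) (sum-replicate-zero n)

  sum-neg : ∀ {n} (f : Fin n → Carrier) → sum (λ i → - f i) ≈ - sum f
  sum-neg {zero} f = sym -0#≈0#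
  sum-neg {suc n} f = trans (+-congˡ (sum-neg (f ∘ suc))) (-‿+-comm _ _)

  I : ∀ {m} → Mat R m
  I = idMat R

  I-diagonal : ∀ {m} (i : Fin m) → I i i ≈ 1#
  I-diagonal i with i Fin.≟ i
  ... | yes _ = refl
  ... | no i≢i = ⊥-elim (i≢i ≡.refl)

  I-offDiagonal : ∀ {m} {i j : Fin m} → i ≢ j → I i j ≈ 0#
  I-offDiagonal {i = i} {j} i≢j with i Fin.≟ j
  ... | yes i≡j = ⊥-elim (i≢j i≡j)
  ... | no _ = refl

  I-suc : ∀ {m} (i j : Fin m) → I (suc i) (suc j) ≈ I i j
  I-suc i j = by-cases (i Fin.≟ j)
    where
    by-cases : Dec (i ≡ j) → I (suc i) (suc j) ≈ I i j
    by-cases (yes ≡.refl) = trans (I-diagonal (suc i)) (sym (I-diagonal i))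
    by-cases (no i≢j) = trans (I-offDiagonal (i≢j ∘ Fin.suc-injective)) (sym (I-offDiagonal i≢j))

  I-sym : ∀ {m} (i j : Fin m) → I i j ≈ I j i
  I-sym i j = by-cases (i Fin.≟ j)
    where
    by-cases : Dec (i ≡ j) → I i j ≈ I j i
    by-cases (yes ≡.refl) = refl
    by-cases (no i≢j) = trans (I-offDiagonal i≢j) (sym (I-offDiagonal (i≢j ∘ ≡.sym)))

  ∑-*-I : ∀ {n} (f : Fin n → Carrier) (j : Fin n) → sum (λ k → f k * I k j) ≈ f j
  ∑-*-I {suc n} f zero = begin
    sum (λ k → f k * I k zero)
      ≈⟨ +-cong (trans (*-congˡ (I-diagonal {suc n} zero)) (*-identityʳ _))
                (sum-zero {n} (λ k → trans (*-congˡ (I-offDiagonal {i = suc k} {j = zero} λ ())) (zeroʳ _))) ⟩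
    f zero + 0# ≈⟨ +-identityʳ _ ⟩
    f zero ∎
    where open SetoidReasoning setoid
  ∑-*-I {suc n} f (suc j) = begin
    sum (λ k → f k * I k (suc j))
      ≈⟨ +-cong (trans (*-congˡ (I-offDiagonal {i = zero} {j = suc j} λ ())) (zeroʳ _))
                (sum-cong-≋ {n} (λ k → *-congˡ (I-suc k j))) ⟩
    0# + sum (λ k → f (suc k) * I k j) ≈⟨ +-identityˡ _ ⟩
    sum (λ k → f (suc k) * I k j) ≈⟨ ∑-*-I (f ∘ suc) j ⟩
    f (suc j) ∎
    where open SetoidReasoning setoid

  ∑-I-* : ∀ {n} (f : Fin n → Carrier) (j : Fin n) → sum (λ k → I j k * f k) ≈ f j
  ∑-I-* {n} f j = trans (sum-cong-≋ {n} (λ k → trans (*-comm _ _) (*-congˡ (I-sym j k)))) (∑-*-I f j)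

  infixl 7 _⋅_
  _⋅_ : ∀ {m} → Mat R m → Mat R m → Mat R m
  _⋅_ = _·ₘ_ R

  infix 4 _≋_
  _≋_ : ∀ {m} → Mat R m → Mat R m → Set ℓ
  _≋_ = _≈ₘ_ R

  infix 8 _ᵀ
  _ᵀ : ∀ {m} → Mat R m → Mat R m
  _ᵀ = transpose R

  infixr 7 _·_
  _·_ : ∀ {m} → Mat R m → Vec' R m → Vec' R m
  _·_ = _·ᵥ_ R

  infix 4 _≈v_
  _≈v_ : ∀ {m} → Vec' R m → Vec' R m → Set ℓ
  _≈v_ = _≈ᵥ_ R

  ≋-setoid : ℕ → Setoid c ℓ
  ≋-setoid m = PointwiseEquality.≋-setoid (PointwiseEquality.≋-setoid setoid m) m

  module ≋-Reasoning {m : ℕ} = SetoidReasoning (≋-setoid m)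

  module _ {m : ℕ} where
    open Setoid (≋-setoid m) public using () renaming (refl to ≋-refl; sym to ≋-sym; trans to ≋-trans)

  ⋅-cong : ∀ {m} {A A′ B B′ : Mat R m} → A ≋ A′ → B ≋ B′ → A ⋅ B ≋ A′ ⋅ B′
  ⋅-cong {m} A≋A′ B≋B′ i j = sum-cong-≋ {m} (λ k → *-cong (A≋A′ i k) (B≋B′ k j))

  ⋅-congˡ : ∀ {m} {A B B′ : Mat R m} → B ≋ B′ → A ⋅ B ≋ A ⋅ B′
  ⋅-congˡ = ⋅-cong ≋-refl

  ⋅-congʳ : ∀ {m} {A A′ B : Mat R m} → A ≋ A′ → A ⋅ B ≋ A′ ⋅ B
  ⋅-congʳ A≋A′ = ⋅-cong A≋A′ ≋-refl

  ⋅-·-assoc : ∀ {m} (A B : Mat R m) (x : Vec' R m) → (A ⋅ B) · x ≈v A · (B · x)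
  ⋅-·-assoc {m} A B x i = begin
    sum (λ k → sum (λ l → A i l * B l k) * x k)
      ≈⟨ sum-cong-≋ {m} (λ k → *-distribʳ-sum (x k) (λ l → A i l * B l k)) ⟩
    sum (λ k → sum (λ l → A i l * B l k * x k))
      ≈⟨ ∑-comm (λ k l → A i l * B l k * x k) ⟩
    sum (λ l → sum (λ k → A i l * B l k * x k))
      ≈⟨ sum-cong-≋ {m} (λ l → sum-cong-≋ {m} (λ k → *-assoc _ _ _)) ⟩
    sum (λ l → sum (λ k → A i l * (B l k * x k)))
      ≈⟨ sum-cong-≋ {m} (λ l → *-distribˡ-sum (A i l) (λ k → B l k * x k)) ⟨
    sum (λ l → A i l * sum (λ k → B l k * x k)) ∎
    where open SetoidReasoning setoid

  ⋅-assoc : ∀ {m} (A B C : Mat R m) → A ⋅ B ⋅ C ≋ A ⋅ (B ⋅ C)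
  ⋅-assoc A B C i j = ⋅-·-assoc A B (λ k → C k j) i

  ⋅-identityʳ : ∀ {m} (A : Mat R m) → A ⋅ I ≋ A
  ⋅-identityʳ A i j = ∑-*-I (A i) j

  ⋅-identityˡ : ∀ {m} (A : Mat R m) → I ⋅ A ≋ A
  ⋅-identityˡ A i j = ∑-I-* (λ k → A k j) i

  ᵀ-cong : ∀ {m} {A B : Mat R m} → A ≋ B → A ᵀ ≋ B ᵀ
  ᵀ-cong A≋B i j = A≋B j i

  ᵀ-anti-homo-⋅ : ∀ {m} (A B : Mat R m) → (A ⋅ B) ᵀ ≋ B ᵀ ⋅ A ᵀ
  ᵀ-anti-homo-⋅ {m} A B i j = sum-cong-≋ {m} (λ k → *-comm _ _)

  I-ᵀ : ∀ {m} → I {m} ᵀ ≋ I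
  I-ᵀ i j = I-sym j i

  Invertible : ∀ {m} → Mat R m → Set (c ⊔ ℓ)
  Invertible = IsInvertible R

  ⋅-invertible : ∀ {m} {A B : Mat R m} → Invertible A → Invertible B → Invertible (A ⋅ B)
  ⋅-invertible {A = A} {B} (A⁻¹ , AA⁻¹ , A⁻¹A) (B⁻¹ , BB⁻¹ , B⁻¹B) =
    B⁻¹ ⋅ A⁻¹ , cancelMiddle A B B⁻¹ A⁻¹ BB⁻¹ AA⁻¹ , cancelMiddle B⁻¹ A⁻¹ A B A⁻¹A B⁻¹B
    where
    cancelMiddle : ∀ X Y Y′ X′ → Y ⋅ Y′ ≋ I → X ⋅ X′ ≋ I → X ⋅ Y ⋅ (Y′ ⋅ X′) ≋ I
    cancelMiddle X Y Y′ X′ YY′ XX′ = begin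
      X ⋅ Y ⋅ (Y′ ⋅ X′) ≈⟨ ⋅-assoc X Y (Y′ ⋅ X′) ⟩
      X ⋅ (Y ⋅ (Y′ ⋅ X′)) ≈⟨ ⋅-congˡ (⋅-assoc Y Y′ X′) ⟨
      X ⋅ (Y ⋅ Y′ ⋅ X′) ≈⟨ ⋅-congˡ (≋-trans (⋅-congʳ YY′) (⋅-identityˡ X′)) ⟩
      X ⋅ X′ ≈⟨ XX′ ⟩
      I ∎
      where open ≋-Reasoning

  ᵀ-invertible : ∀ {m} {A : Mat R m} → Invertible A → Invertible (A ᵀ)
  ᵀ-invertible {A = A} (A⁻¹ , AA⁻¹ , A⁻¹A) =
    A⁻¹ ᵀ , ≋-trans (≋-sym (ᵀ-anti-homo-⋅ A⁻¹ A)) (≋-trans (ᵀ-cong A⁻¹A) I-ᵀ)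
          , ≋-trans (≋-sym (ᵀ-anti-homo-⋅ A A⁻¹)) (≋-trans (ᵀ-cong AA⁻¹) I-ᵀ)

  invertible-cong : ∀ {m} {A B : Mat R m} → A ≋ B → Invertible A → Invertible B
  invertible-cong A≋B (A⁻¹ , AA⁻¹ , A⁻¹A) =
    A⁻¹ , ≋-trans (⋅-congʳ (≋-sym A≋B)) AA⁻¹ , ≋-trans (⋅-congˡ (≋-sym A≋B)) A⁻¹A

  left-inverse≋right-inverse : ∀ {m} {A B C : Mat R m} → B ⋅ A ≋ I → A ⋅ C ≋ I → B ≋ C
  left-inverse≋right-inverse {A = A} {B} {C} BA≋I AC≋I = begin
    B ≈⟨ ⋅-identityʳ B ⟨
    B ⋅ I ≈⟨ ⋅-congˡ AC≋I ⟨
    B ⋅ (A ⋅ C) ≈⟨ ⋅-assoc B A C ⟨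
    B ⋅ A ⋅ C ≈⟨ ⋅-congʳ BA≋I ⟩
    I ⋅ C ≈⟨ ⋅-identityˡ C ⟩
    C ∎
    where open ≋-Reasoning

  invertible⇒¬zeroRow : ∀ {m} {K : Mat R m} → Invertible K → ¬ (1# ≈ 0#) → ∀ i → ¬ (∀ l → K i l ≈ 0#)
  invertible⇒¬zeroRow {K = K} (K⁻¹ , KK⁻¹ , _) 1≉0 i Kᵢ≈0 =
    1≉0 (trans (sym (I-diagonal i)) (trans (sym (KK⁻¹ i i)) (sum-zero (λ l → trans (*-congʳ (Kᵢ≈0 l)) (zeroˡ _)))))

  ·-cong : ∀ {m} {A B : Mat R m} {x y : Vec' R m} → A ≋ B → x ≈v y → A · x ≈v B · y
  ·-cong {m} A≋B x≈y i = sum-cong-≋ {m} (λ k → *-cong (A≋B i k) (x≈y k))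

  I-· : ∀ {m} (x : Vec' R m) → I · x ≈v x
  I-· x i = ∑-I-* x i

  ·-scale : ∀ {m} (A : Mat R m) (s : Carrier) (x : Vec' R m) → A · (λ i → s * x i) ≈v (λ i → s * (A · x) i)
  ·-scale {m} A s x i = trans (sum-cong-≋ {m} (λ k → solve 3 (λ a b c → a :* (b :* c) := b :* (a :* c)) refl (A i k) s (x k)))
                             (sym (*-distribˡ-sum s (λ k → A i k * x k)))

  inverse-·-cancel : ∀ {m} {A B : Mat R m} → B ⋅ A ≋ I → ∀ x → B · (A · x) ≈v x
  inverse-·-cancel {A = A} {B} BA≋I x i = trans (sym (⋅-·-assoc B A x i)) (trans (·-cong BA≋I (λ _ → refl) i) (I-· x i))

  invertible-·-nonZero : ∀ {m} {A B : Mat R m} → B ⋅ A ≋ I → ∀ {x} → NonZeroVec R x → NonZeroVec R (A · x)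
  invertible-·-nonZero {A = A} {B} BA≋I {x} x≉0 Ax≈0 =
    x≉0 (λ i → trans (sym (inverse-·-cancel BA≋I x i)) (sum-zero (λ k → trans (*-congˡ (Ax≈0 k)) (zeroʳ _))))

  Gram : ∀ {m} → Mat R m → Mat R m → Mat R m
  Gram C K = C ᵀ ⋅ K ⋅ C

  Gram-cong : ∀ {m} {C C′ K K′ : Mat R m} → C ≋ C′ → K ≋ K′ → Gram C K ≋ Gram C′ K′
  Gram-cong C≋C′ K≋K′ = ⋅-cong (⋅-cong (ᵀ-cong C≋C′) K≋K′) C≋C′

  Gram-⋅ : ∀ {m} (C D K : Mat R m) → Gram (C ⋅ D) K ≋ Gram D (Gram C K)
  Gram-⋅ C D K = begin
    (C ⋅ D) ᵀ ⋅ K ⋅ (C ⋅ D) ≈⟨ ⋅-congʳ (⋅-congʳ (ᵀ-anti-homo-⋅ C D)) ⟩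
    D ᵀ ⋅ C ᵀ ⋅ K ⋅ (C ⋅ D) ≈⟨ ⋅-assoc (D ᵀ ⋅ C ᵀ ⋅ K) C D ⟨
    D ᵀ ⋅ C ᵀ ⋅ K ⋅ C ⋅ D ≈⟨ ⋅-congʳ (≋-trans (⋅-congʳ (⋅-assoc (D ᵀ) (C ᵀ) K)) (⋅-assoc (D ᵀ) (C ᵀ ⋅ K) C)) ⟩
    D ᵀ ⋅ Gram C K ⋅ D ∎
    where open ≋-Reasoning

  Gram-invertible : ∀ {m} {C K : Mat R m} → Invertible C → Invertible K → Invertible (Gram C K)
  Gram-invertible C⁻¹ K⁻¹ = ⋅-invertible (⋅-invertible (ᵀ-invertible C⁻¹) K⁻¹) C⁻¹

  Gram-entry : ∀ {m} (C K : Mat R m) i j → Gram C K i j ≈ sum (λ k → sum (λ l → C k i * K k l * C l j))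
  Gram-entry {m} C K i j = begin
    sum (λ l → sum (λ k → C k i * K k l) * C l j) ≈⟨ sum-cong-≋ {m} (λ l → *-distribʳ-sum (C l j) (λ k → C k i * K k l)) ⟩
    sum (λ l → sum (λ k → C k i * K k l * C l j)) ≈⟨ ∑-comm (λ l k → C k i * K k l * C l j) ⟩
    sum (λ k → sum (λ l → C k i * K k l * C l j)) ∎
    where open SetoidReasoning setoid

  IsAlternating : ∀ {m} → Mat R m → Set ℓ
  IsAlternating K = (∀ i → K i i ≈ 0#) × (∀ i j → K j i ≈ - K i j)

  alternating-isotropic : ∀ {n} {K : Mat R n} → IsAlternating K → (x : Vec' R n) →
    sum (λ k → sum (λ l → x k * K k l * x l)) ≈ 0#
  alternating-isotropic {zero} _ x = refl
  alternating-isotropic {suc n} {K} (K-diag , K-anti) x = begin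
    (x₀ * K zero zero * x₀ + row₀) + sum (λ k → x (suc k) * K (suc k) zero * x₀ + rest k)
      ≈⟨ +-cong (+-congʳ diag≈0) (∑-distrib-+ (λ k → x (suc k) * K (suc k) zero * x₀) rest) ⟩
    (0# + row₀) + (sum (λ k → x (suc k) * K (suc k) zero * x₀) + sum rest)
      ≈⟨ +-cong (+-identityˡ row₀) (+-cong (trans (sum-cong-≋ {n} column≈-row) (sum-neg (λ l → x₀ * K zero (suc l) * x (suc l))))
                                           (alternating-isotropic K′-alternating (x ∘ suc))) ⟩
    row₀ + (- row₀ + 0#) ≈⟨ +-congˡ (+-identityʳ _) ⟩
    row₀ + - row₀ ≈⟨ -‿inverseʳ row₀ ⟩
    0# ∎
    where
    open SetoidReasoning setoid
    x₀ row₀ : Carrier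
    x₀ = x zero
    row₀ = sum (λ l → x₀ * K zero (suc l) * x (suc l))
    rest : Fin n → Carrier
    rest k = sum (λ l → x (suc k) * K (suc k) (suc l) * x (suc l))
    K′-alternating : IsAlternating (λ a b → K (suc a) (suc b))
    K′-alternating = K-diag ∘ suc , λ i j → K-anti (suc i) (suc j)
    diag≈0 : x₀ * K zero zero * x₀ ≈ 0#
    diag≈0 = trans (*-congʳ (trans (*-congˡ (K-diag zero)) (zeroʳ _))) (zeroˡ _)
    column≈-row : ∀ k → x (suc k) * K (suc k) zero * x₀ ≈ - (x₀ * K zero (suc k) * x (suc k))
    column≈-row k = begin
      x (suc k) * K (suc k) zero * x₀ ≈⟨ *-congʳ (*-congˡ (K-anti zero (suc k))) ⟩
      x (suc k) * - K zero (suc k) * x₀ ≈⟨ *-congʳ (-‿distribʳ-* _ _) ⟨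
      - (x (suc k) * K zero (suc k)) * x₀ ≈⟨ -‿distribˡ-* _ _ ⟨
      - (x (suc k) * K zero (suc k) * x₀) ≈⟨ -‿cong (solve 3 (λ a b c → a :* b :* c := c :* b :* a) refl _ _ _) ⟩
      - (x₀ * K zero (suc k) * x (suc k)) ∎

  Gram-alternating : ∀ {m} (C : Mat R m) {K : Mat R m} → IsAlternating K → IsAlternating (Gram C K)
  Gram-alternating {m} C {K} K-alt@(_ , K-anti) = diag , anti
    where
    open SetoidReasoning setoid
    diag : ∀ i → Gram C K i i ≈ 0#
    diag i = trans (Gram-entry C K i i) (alternating-isotropic K-alt (λ k → C k i))
    swapped : ∀ i j l k → C k j * K k l * C l i ≈ - (C l i * K l k * C k j)
    swapped i j l k = begin
      C k j * K k l * C l i ≈⟨ *-congʳ (*-congˡ (K-anti l k)) ⟩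
      C k j * - K l k * C l i ≈⟨ *-congʳ (-‿distribʳ-* _ _) ⟨
      - (C k j * K l k) * C l i ≈⟨ -‿distribˡ-* _ _ ⟨
      - (C k j * K l k * C l i) ≈⟨ -‿cong (solve 3 (λ a b c → a :* b :* c := c :* b :* a) refl _ _ _) ⟩
      - (C l i * K l k * C k j) ∎
    anti : ∀ i j → Gram C K j i ≈ - Gram C K i j
    anti i j = begin
      Gram C K j i ≈⟨ Gram-entry C K j i ⟩
      sum (λ k → sum (λ l → C k j * K k l * C l i)) ≈⟨ ∑-comm (λ k l → C k j * K k l * C l i) ⟩
      sum (λ l → sum (λ k → C k j * K k l * C l i)) ≈⟨ sum-cong-≋ {m} (λ l → sum-cong-≋ {m} (swapped i j l)) ⟩
      sum (λ l → sum (λ k → - (C l i * K l k * C k j))) ≈⟨ sum-cong-≋ {m} (λ l → sum-neg (λ k → C l i * K l k * C k j)) ⟩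
      sum (λ l → - sum (λ k → C l i * K l k * C k j)) ≈⟨ sum-neg (λ l → sum (λ k → C l i * K l k * C k j)) ⟩
      - sum (λ l → sum (λ k → C l i * K l k * C k j)) ≈⟨ -‿cong (Gram-entry C K i j) ⟨
      - Gram C K i j ∎

  infixr 7 _∙ₘ_
  _∙ₘ_ : ∀ {m} → Carrier → Mat R m → Mat R m
  (s ∙ₘ K) i j = s * K i j

  ∙ₘ-⋅-∙ₘ : ∀ {m} (s t : Carrier) (X Y : Mat R m) → (s ∙ₘ X) ⋅ (t ∙ₘ Y) ≋ (s * t) ∙ₘ (X ⋅ Y)
  ∙ₘ-⋅-∙ₘ {m} s t X Y i j =
    trans (sum-cong-≋ {m} (λ k → solve 4 (λ a b c d → (a :* b) :* (c :* d) := (a :* c) :* (b :* d)) refl s (X i k) t (Y k j)))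
          (sym (*-distribˡ-sum (s * t) (λ k → X i k * Y k j)))

  ∙ₘ-inverse : ∀ {m} {s t : Carrier} {X Y : Mat R m} → s * t ≈ 1# → X ⋅ Y ≋ I → (s ∙ₘ X) ⋅ (t ∙ₘ Y) ≋ I
  ∙ₘ-inverse {s = s} {t} {X} {Y} st≈1 XY≈I i j =
    trans (∙ₘ-⋅-∙ₘ s t X Y i j) (trans (*-cong st≈1 (XY≈I i j)) (*-identityˡ _))

  ∙ₘ-invertible : ∀ {m} {K : Mat R m} {s t : Carrier} → s * t ≈ 1# → Invertible K → Invertible (s ∙ₘ K)
  ∙ₘ-invertible {s = s} {t} st≈1 (K⁻¹ , KK⁻¹ , K⁻¹K) =
    t ∙ₘ K⁻¹ , ∙ₘ-inverse st≈1 KK⁻¹ , ∙ₘ-inverse (trans (*-comm t s) st≈1) K⁻¹K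

  ∙ₘ-alternating : ∀ {m} (s : Carrier) {K : Mat R m} → IsAlternating K → IsAlternating (s ∙ₘ K)
  ∙ₘ-alternating s (K-diag , K-anti) =
    (λ i → trans (*-congˡ (K-diag i)) (zeroʳ s)) , (λ i j → trans (*-congˡ (K-anti i j)) (sym (-‿distribʳ-* s _)))

  Gram-∙ₘ : ∀ {m} (s : Carrier) (C K : Mat R m) → Gram C (s ∙ₘ K) ≋ s ∙ₘ Gram C K
  Gram-∙ₘ {m} s C K i j = begin
    sum (λ l → sum (λ k → C k i * (s * K k l)) * C l j)
      ≈⟨ sum-cong-≋ {m} (λ l → *-congʳ (sum-cong-≋ {m} (λ k →
           solve 3 (λ a b c → a :* (b :* c) := b :* (a :* c)) refl (C k i) s (K k l)))) ⟩
    sum (λ l → sum (λ k → s * (C k i * K k l)) * C l j)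
      ≈⟨ sum-cong-≋ {m} (λ l → *-congʳ (*-distribˡ-sum s (λ k → C k i * K k l))) ⟨
    sum (λ l → s * sum (λ k → C k i * K k l) * C l j)
      ≈⟨ sum-cong-≋ {m} (λ l → *-assoc _ _ _) ⟩
    sum (λ l → s * (sum (λ k → C k i * K k l) * C l j))
      ≈⟨ *-distribˡ-sum s (λ l → sum (λ k → C k i * K k l) * C l j) ⟨
    s * Gram C K i j ∎
    where open SetoidReasoning setoid

  permutationMatrix : ∀ {m} → (Fin m → Fin m) → Mat R m
  permutationMatrix π a b = I a (π b)

  Gram-permutationMatrix : ∀ {m} (π : Fin m → Fin m) (K : Mat R m) →
    Gram (permutationMatrix π) K ≋ (λ a b → K (π a) (π b))
  Gram-permutationMatrix {m} π K a b = begin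
    sum (λ l → sum (λ k → I k (π a) * K k l) * I l (π b))
      ≈⟨ sum-cong-≋ {m} (λ l → *-congʳ (trans (sum-cong-≋ {m} (λ k → *-congʳ (I-sym k (π a)))) (∑-I-* (λ k → K k l) (π a)))) ⟩
    sum (λ l → K (π a) l * I l (π b)) ≈⟨ ∑-*-I (K (π a)) (π b) ⟩
    K (π a) (π b) ∎
    where open SetoidReasoning setoid

  permutationMatrix-inverse : ∀ {m} {π π⁻¹ : Fin m → Fin m} → (∀ b → π (π⁻¹ b) ≡ b) →
    permutationMatrix π ⋅ permutationMatrix π⁻¹ ≋ I
  permutationMatrix-inverse {π = π} {π⁻¹} ππ⁻¹ a b =
    trans (∑-*-I (λ k → I a (π k)) (π⁻¹ b)) (reflexive (≡.cong (I a) (ππ⁻¹ b)))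

  -- block a₀₀ a₀₁ a₁₀ a₁₁ r₀ r₁ c₀ c₁ M is the matrix with rows (a₀₀ a₀₁ r₀), (a₁₀ a₁₁ r₁), (c₀ c₁ M).
  block : ∀ {m} (a₀₀ a₀₁ a₁₀ a₁₁ : Carrier) (r₀ r₁ c₀ c₁ : Fin m → Carrier) → Mat R m → Mat R (suc (suc m))
  block a₀₀ a₀₁ a₁₀ a₁₁ r₀ r₁ c₀ c₁ M zero zero = a₀₀
  block a₀₀ a₀₁ a₁₀ a₁₁ r₀ r₁ c₀ c₁ M zero (suc zero) = a₀₁
  block a₀₀ a₀₁ a₁₀ a₁₁ r₀ r₁ c₀ c₁ M (suc zero) zero = a₁₀
  block a₀₀ a₀₁ a₁₀ a₁₁ r₀ r₁ c₀ c₁ M (suc zero) (suc zero) = a₁₁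
  block a₀₀ a₀₁ a₁₀ a₁₁ r₀ r₁ c₀ c₁ M zero (suc (suc b)) = r₀ b
  block a₀₀ a₀₁ a₁₀ a₁₁ r₀ r₁ c₀ c₁ M (suc zero) (suc (suc b)) = r₁ b
  block a₀₀ a₀₁ a₁₀ a₁₁ r₀ r₁ c₀ c₁ M (suc (suc a)) zero = c₀ a
  block a₀₀ a₀₁ a₁₀ a₁₁ r₀ r₁ c₀ c₁ M (suc (suc a)) (suc zero) = c₁ a
  block a₀₀ a₀₁ a₁₀ a₁₁ r₀ r₁ c₀ c₁ M (suc (suc a)) (suc (suc b)) = M a b

  block-cong : ∀ {m} {a₀₀ a₀₁ a₁₀ a₁₁ b₀₀ b₀₁ b₁₀ b₁₁ : Carrier} {r₀ r₁ c₀ c₁ s₀ s₁ d₀ d₁ : Fin m → Carrier} {M N : Mat R m} →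
    a₀₀ ≈ b₀₀ → a₀₁ ≈ b₀₁ → a₁₀ ≈ b₁₀ → a₁₁ ≈ b₁₁ →
    (∀ i → r₀ i ≈ s₀ i) → (∀ i → r₁ i ≈ s₁ i) → (∀ i → c₀ i ≈ d₀ i) → (∀ i → c₁ i ≈ d₁ i) → M ≋ N →
    block a₀₀ a₀₁ a₁₀ a₁₁ r₀ r₁ c₀ c₁ M ≋ block b₀₀ b₀₁ b₁₀ b₁₁ s₀ s₁ d₀ d₁ N
  block-cong e₀₀ e₀₁ e₁₀ e₁₁ er₀ er₁ ec₀ ec₁ eM zero zero = e₀₀
  block-cong e₀₀ e₀₁ e₁₀ e₁₁ er₀ er₁ ec₀ ec₁ eM zero (suc zero) = e₀₁
  block-cong e₀₀ e₀₁ e₁₀ e₁₁ er₀ er₁ ec₀ ec₁ eM (suc zero) zero = e₁₀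
  block-cong e₀₀ e₀₁ e₁₀ e₁₁ er₀ er₁ ec₀ ec₁ eM (suc zero) (suc zero) = e₁₁
  block-cong e₀₀ e₀₁ e₁₀ e₁₁ er₀ er₁ ec₀ ec₁ eM zero (suc (suc b)) = er₀ b
  block-cong e₀₀ e₀₁ e₁₀ e₁₁ er₀ er₁ ec₀ ec₁ eM (suc zero) (suc (suc b)) = er₁ b
  block-cong e₀₀ e₀₁ e₁₀ e₁₁ er₀ er₁ ec₀ ec₁ eM (suc (suc a)) zero = ec₀ a
  block-cong e₀₀ e₀₁ e₁₀ e₁₁ er₀ er₁ ec₀ ec₁ eM (suc (suc a)) (suc zero) = ec₁ a
  block-cong e₀₀ e₀₁ e₁₀ e₁₁ er₀ er₁ ec₀ ec₁ eM (suc (suc a)) (suc (suc b)) = eM a b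

  block-⋅ : ∀ {m} (a₀₀ a₀₁ a₁₀ a₁₁ : Carrier) (r₀ r₁ c₀ c₁ : Fin m → Carrier) (M : Mat R m)
                  (b₀₀ b₀₁ b₁₀ b₁₁ : Carrier) (s₀ s₁ d₀ d₁ : Fin m → Carrier) (N : Mat R m) →
    block a₀₀ a₀₁ a₁₀ a₁₁ r₀ r₁ c₀ c₁ M ⋅ block b₀₀ b₀₁ b₁₀ b₁₁ s₀ s₁ d₀ d₁ N ≋
    block (a₀₀ * b₀₀ + (a₀₁ * b₁₀ + sum (λ k → r₀ k * d₀ k)))
          (a₀₀ * b₀₁ + (a₀₁ * b₁₁ + sum (λ k → r₀ k * d₁ k)))
          (a₁₀ * b₀₀ + (a₁₁ * b₁₀ + sum (λ k → r₁ k * d₀ k)))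
          (a₁₀ * b₀₁ + (a₁₁ * b₁₁ + sum (λ k → r₁ k * d₁ k)))
          (λ b → a₀₀ * s₀ b + (a₀₁ * s₁ b + sum (λ k → r₀ k * N k b)))
          (λ b → a₁₀ * s₀ b + (a₁₁ * s₁ b + sum (λ k → r₁ k * N k b)))
          (λ a → c₀ a * b₀₀ + (c₁ a * b₁₀ + sum (λ k → M a k * d₀ k)))
          (λ a → c₀ a * b₀₁ + (c₁ a * b₁₁ + sum (λ k → M a k * d₁ k)))
          (λ a b → c₀ a * s₀ b + (c₁ a * s₁ b + sum (λ k → M a k * N k b)))
  block-⋅ _ _ _ _ _ _ _ _ _ _ _ _ _ _ _ _ _ _ zero zero = refl
  block-⋅ _ _ _ _ _ _ _ _ _ _ _ _ _ _ _ _ _ _ zero (suc zero) = refl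
  block-⋅ _ _ _ _ _ _ _ _ _ _ _ _ _ _ _ _ _ _ (suc zero) zero = refl
  block-⋅ _ _ _ _ _ _ _ _ _ _ _ _ _ _ _ _ _ _ (suc zero) (suc zero) = refl
  block-⋅ _ _ _ _ _ _ _ _ _ _ _ _ _ _ _ _ _ _ zero (suc (suc b)) = refl
  block-⋅ _ _ _ _ _ _ _ _ _ _ _ _ _ _ _ _ _ _ (suc zero) (suc (suc b)) = refl
  block-⋅ _ _ _ _ _ _ _ _ _ _ _ _ _ _ _ _ _ _ (suc (suc a)) zero = refl
  block-⋅ _ _ _ _ _ _ _ _ _ _ _ _ _ _ _ _ _ _ (suc (suc a)) (suc zero) = refl
  block-⋅ _ _ _ _ _ _ _ _ _ _ _ _ _ _ _ _ _ _ (suc (suc a)) (suc (suc b)) = refl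

  block-ᵀ : ∀ {m} (a₀₀ a₀₁ a₁₀ a₁₁ : Carrier) (r₀ r₁ c₀ c₁ : Fin m → Carrier) (M : Mat R m) →
    block a₀₀ a₀₁ a₁₀ a₁₁ r₀ r₁ c₀ c₁ M ᵀ ≋ block a₀₀ a₁₀ a₀₁ a₁₁ c₀ c₁ r₀ r₁ (M ᵀ)
  block-ᵀ _ _ _ _ _ _ _ _ _ zero zero = refl
  block-ᵀ _ _ _ _ _ _ _ _ _ zero (suc zero) = refl
  block-ᵀ _ _ _ _ _ _ _ _ _ (suc zero) zero = refl
  block-ᵀ _ _ _ _ _ _ _ _ _ (suc zero) (suc zero) = refl
  block-ᵀ _ _ _ _ _ _ _ _ _ zero (suc (suc b)) = refl
  block-ᵀ _ _ _ _ _ _ _ _ _ (suc zero) (suc (suc b)) = refl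
  block-ᵀ _ _ _ _ _ _ _ _ _ (suc (suc a)) zero = refl
  block-ᵀ _ _ _ _ _ _ _ _ _ (suc (suc a)) (suc zero) = refl
  block-ᵀ _ _ _ _ _ _ _ _ _ (suc (suc a)) (suc (suc b)) = refl

  block-η : ∀ {m} (K : Mat R (suc (suc m))) →
    K ≋ block (K zero zero) (K zero (suc zero)) (K (suc zero) zero) (K (suc zero) (suc zero))
              (λ b → K zero (suc (suc b))) (λ b → K (suc zero) (suc (suc b)))
              (λ a → K (suc (suc a)) zero) (λ a → K (suc (suc a)) (suc zero))
              (λ a b → K (suc (suc a)) (suc (suc b)))
  block-η K zero zero = refl
  block-η K zero (suc zero) = refl
  block-η K (suc zero) zero = refl
  block-η K (suc zero) (suc zero) = refl
  block-η K zero (suc (suc b)) = refl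
  block-η K (suc zero) (suc (suc b)) = refl
  block-η K (suc (suc a)) zero = refl
  block-η K (suc (suc a)) (suc zero) = refl
  block-η K (suc (suc a)) (suc (suc b)) = refl

  0ᵥ : ∀ {m} → Vec' R m
  0ᵥ _ = 0#

  I-block : ∀ {m} → I {suc (suc m)} ≋ block 1# 0# 0# 1# 0ᵥ 0ᵥ 0ᵥ 0ᵥ I
  I-block {m} zero zero = I-diagonal {suc (suc m)} zero
  I-block {m} zero (suc zero) = I-offDiagonal {suc (suc m)} {zero} {suc zero} (λ ())
  I-block {m} (suc zero) zero = I-offDiagonal {suc (suc m)} {suc zero} {zero} (λ ())
  I-block {m} (suc zero) (suc zero) = I-diagonal {suc (suc m)} (suc zero)
  I-block {m} zero (suc (suc b)) = I-offDiagonal {suc (suc m)} {zero} {suc (suc b)} (λ ())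
  I-block {m} (suc zero) (suc (suc b)) = I-offDiagonal {suc (suc m)} {suc zero} {suc (suc b)} (λ ())
  I-block {m} (suc (suc a)) zero = I-offDiagonal {suc (suc m)} {suc (suc a)} {zero} (λ ())
  I-block {m} (suc (suc a)) (suc zero) = I-offDiagonal {suc (suc m)} {suc (suc a)} {suc zero} (λ ())
  I-block {m} (suc (suc a)) (suc (suc b)) = trans (I-suc (suc a) (suc b)) (I-suc a b)

  +-only₁ : ∀ {a b s x} → a ≈ x → b ≈ 0# → s ≈ 0# → a + (b + s) ≈ x
  +-only₁ a≈x b≈0 s≈0 = trans (+-cong a≈x (trans (+-cong b≈0 s≈0) (+-identityˡ 0#))) (+-identityʳ _)

  +-only₂ : ∀ {a b s x} → a ≈ 0# → b ≈ x → s ≈ 0# → a + (b + s) ≈ x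
  +-only₂ a≈0 b≈x s≈0 = trans (+-cong a≈0 (+-cong b≈x s≈0)) (trans (+-identityˡ _) (+-identityʳ _))

  +-only₃ : ∀ {a b s x} → a ≈ 0# → b ≈ 0# → s ≈ x → a + (b + s) ≈ x
  +-only₃ a≈0 b≈0 s≈x = trans (+-cong a≈0 (+-cong b≈0 s≈x)) (trans (+-identityˡ _) (+-identityˡ _))

  ∑-0* : ∀ {m} (g : Fin m → Carrier) → sum (λ k → 0# * g k) ≈ 0#
  ∑-0* g = sum-zero (λ k → zeroˡ (g k))

  ∑-*0 : ∀ {m} (g : Fin m → Carrier) → sum (λ k → g k * 0#) ≈ 0#
  ∑-*0 g = sum-zero (λ k → zeroʳ (g k))

  [_,_,_,_]⊕_ : ∀ {m} (a₀₀ a₀₁ a₁₀ a₁₁ : Carrier) → Mat R m → Mat R (suc (suc m))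
  [ a₀₀ , a₀₁ , a₁₀ , a₁₁ ]⊕ M = block a₀₀ a₀₁ a₁₀ a₁₁ 0ᵥ 0ᵥ 0ᵥ 0ᵥ M

  ⊕-cong : ∀ {m} {a₀₀ a₀₁ a₁₀ a₁₁ b₀₀ b₀₁ b₁₀ b₁₁ : Carrier} {M N : Mat R m} →
    a₀₀ ≈ b₀₀ → a₀₁ ≈ b₀₁ → a₁₀ ≈ b₁₀ → a₁₁ ≈ b₁₁ → M ≋ N →
    [ a₀₀ , a₀₁ , a₁₀ , a₁₁ ]⊕ M ≋ [ b₀₀ , b₀₁ , b₁₀ , b₁₁ ]⊕ N
  ⊕-cong e₀₀ e₀₁ e₁₀ e₁₁ = block-cong e₀₀ e₀₁ e₁₀ e₁₁ (λ _ → refl) (λ _ → refl) (λ _ → refl) (λ _ → refl)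

  ⊕-⋅ : ∀ {m} (a₀₀ a₀₁ a₁₀ a₁₁ b₀₀ b₀₁ b₁₀ b₁₁ : Carrier) (M N : Mat R m) →
    [ a₀₀ , a₀₁ , a₁₀ , a₁₁ ]⊕ M ⋅ [ b₀₀ , b₀₁ , b₁₀ , b₁₁ ]⊕ N ≋
    [ a₀₀ * b₀₀ + a₀₁ * b₁₀ , a₀₀ * b₀₁ + a₀₁ * b₁₁ , a₁₀ * b₀₀ + a₁₁ * b₁₀ , a₁₀ * b₀₁ + a₁₁ * b₁₁ ]⊕ (M ⋅ N)
  ⊕-⋅ {m} a₀₀ a₀₁ a₁₀ a₁₁ b₀₀ b₀₁ b₁₀ b₁₁ M N =
    ≋-trans (block-⋅ a₀₀ a₀₁ a₁₀ a₁₁ 0ᵥ 0ᵥ 0ᵥ 0ᵥ M b₀₀ b₀₁ b₁₀ b₁₁ 0ᵥ 0ᵥ 0ᵥ 0ᵥ N)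
      (block-cong corner corner corner corner
                  (λ b → +-only₃ (zeroʳ _) (zeroʳ _) (∑-0* (λ k → N k b)))
                  (λ b → +-only₃ (zeroʳ _) (zeroʳ _) (∑-0* (λ k → N k b)))
                  (λ a → +-only₃ (zeroˡ _) (zeroˡ _) (∑-*0 (M a)))
                  (λ a → +-only₃ (zeroˡ _) (zeroˡ _) (∑-*0 (M a)))
                  (λ a b → +-only₃ (zeroˡ _) (zeroˡ _) refl))
    where
    corner : ∀ {x y} → x + (y + sum (λ k → 0ᵥ {m} k * 0ᵥ {m} k)) ≈ x + y
    corner = +-congˡ (trans (+-congˡ (∑-0* (0ᵥ {m}))) (+-identityʳ _))

  ⊕-ᵀ : ∀ {m} (a₀₀ a₀₁ a₁₀ a₁₁ : Carrier) (M : Mat R m) →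
    ([ a₀₀ , a₀₁ , a₁₀ , a₁₁ ]⊕ M) ᵀ ≋ [ a₀₀ , a₁₀ , a₀₁ , a₁₁ ]⊕ (M ᵀ)
  ⊕-ᵀ a₀₀ a₀₁ a₁₀ a₁₁ = block-ᵀ a₀₀ a₀₁ a₁₀ a₁₁ 0ᵥ 0ᵥ 0ᵥ 0ᵥ

  I₂⊕_ : ∀ {m} → Mat R m → Mat R (suc (suc m))
  I₂⊕ D = [ 1# , 0# , 0# , 1# ]⊕ D

  H⊕_ : ∀ {m} → Mat R m → Mat R (suc (suc m))
  H⊕ K = [ 0# , 1# , - 1# , 0# ]⊕ K

  -- The standard alternating matrix, H ⊕ H ⊕ … ; for odd m it ends in a (junk, singular) zero block.
  Ω : ∀ {m} → Mat R m
  Ω {zero} _ _ = 0#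
  Ω {suc zero} _ _ = 0#
  Ω {suc (suc m)} = H⊕ Ω

  I₂⊕-⋅-⊕ : ∀ {m} (D : Mat R m) (a₀₀ a₀₁ a₁₀ a₁₁ : Carrier) (M : Mat R m) →
    I₂⊕ D ⋅ [ a₀₀ , a₀₁ , a₁₀ , a₁₁ ]⊕ M ≋ [ a₀₀ , a₀₁ , a₁₀ , a₁₁ ]⊕ (D ⋅ M)
  I₂⊕-⋅-⊕ D a₀₀ a₀₁ a₁₀ a₁₁ M =
    ≋-trans (⊕-⋅ 1# 0# 0# 1# a₀₀ a₀₁ a₁₀ a₁₁ D M)
            (⊕-cong (first a₀₀ a₁₀) (first a₀₁ a₁₁) (second a₀₀ a₁₀) (second a₀₁ a₁₁) ≋-refl)
    where
    first : ∀ x y → 1# * x + 0# * y ≈ x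
    first x y = trans (+-cong (*-identityˡ x) (zeroˡ y)) (+-identityʳ x)
    second : ∀ x y → 0# * x + 1# * y ≈ y
    second x y = trans (+-cong (zeroˡ x) (*-identityˡ y)) (+-identityˡ y)

  ⊕-⋅-I₂⊕ : ∀ {m} (a₀₀ a₀₁ a₁₀ a₁₁ : Carrier) (M D : Mat R m) →
    [ a₀₀ , a₀₁ , a₁₀ , a₁₁ ]⊕ M ⋅ I₂⊕ D ≋ [ a₀₀ , a₀₁ , a₁₀ , a₁₁ ]⊕ (M ⋅ D)
  ⊕-⋅-I₂⊕ a₀₀ a₀₁ a₁₀ a₁₁ M D =
    ≋-trans (⊕-⋅ a₀₀ a₀₁ a₁₀ a₁₁ 1# 0# 0# 1# M D)
            (⊕-cong (first a₀₀ a₀₁) (second a₀₀ a₀₁) (first a₁₀ a₁₁) (second a₁₀ a₁₁) ≋-refl)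
    where
    first : ∀ x y → x * 1# + y * 0# ≈ x
    first x y = trans (+-cong (*-identityʳ x) (zeroʳ y)) (+-identityʳ x)
    second : ∀ x y → x * 0# + y * 1# ≈ y
    second x y = trans (+-cong (zeroʳ x) (*-identityʳ y)) (+-identityˡ y)

  I₂⊕-invertible : ∀ {m} {D : Mat R m} → Invertible D → Invertible (I₂⊕ D)
  I₂⊕-invertible (D⁻¹ , DD⁻¹ , D⁻¹D) =
    I₂⊕ D⁻¹ , ≋-trans (I₂⊕-⋅-⊕ _ 1# 0# 0# 1# D⁻¹) (≋-trans (⊕-cong refl refl refl refl DD⁻¹) (≋-sym I-block))
            , ≋-trans (I₂⊕-⋅-⊕ _ 1# 0# 0# 1# _) (≋-trans (⊕-cong refl refl refl refl D⁻¹D) (≋-sym I-block))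

  Gram-I₂⊕-H⊕ : ∀ {m} (D K : Mat R m) → Gram (I₂⊕ D) (H⊕ K) ≋ H⊕ Gram D K
  Gram-I₂⊕-H⊕ D K = begin
    (I₂⊕ D) ᵀ ⋅ H⊕ K ⋅ I₂⊕ D ≈⟨ ⋅-congʳ {B = I₂⊕ D} (⋅-congʳ {B = H⊕ K} (⊕-ᵀ 1# 0# 0# 1# D)) ⟩
    I₂⊕ (D ᵀ) ⋅ H⊕ K ⋅ I₂⊕ D ≈⟨ ⋅-congʳ {B = I₂⊕ D} (I₂⊕-⋅-⊕ (D ᵀ) 0# 1# (- 1#) 0# K) ⟩
    H⊕ (D ᵀ ⋅ K) ⋅ I₂⊕ D ≈⟨ ⊕-⋅-I₂⊕ 0# 1# (- 1#) 0# (D ᵀ ⋅ K) D ⟩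
    H⊕ Gram D K ∎
    where open ≋-Reasoning

  H⊕-reflects-invertible : ∀ {m} {K : Mat R m} → Invertible (H⊕ K) → Invertible K
  H⊕-reflects-invertible {K = K} (B , KB≈I , BK≈I) =
    (λ a b → B (suc (suc a)) (suc (suc b))) ,
    (λ a b → trans (sym (+-only₃ (zeroˡ _) (zeroˡ _) refl)) (trans (KB≈I (suc (suc a)) (suc (suc b))) (lower a b))) ,
    (λ a b → trans (sym (+-only₃ (zeroʳ _) (zeroʳ _) refl)) (trans (BK≈I (suc (suc a)) (suc (suc b))) (lower a b)))
    where
    lower : ∀ a b → I (suc (suc a)) (suc (suc b)) ≈ I a b
    lower a b = I-block (suc (suc a)) (suc (suc b))

  upperBlock : ∀ {m} → Carrier → (Fin m → Carrier) → (Fin m → Carrier) → Mat R (suc (suc m))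
  upperBlock d X Y = block 1# 0# 0# d X Y 0ᵥ 0ᵥ I

  upperBlock-⋅ : ∀ {m} d (X Y : Fin m → Carrier) d′ (X′ Y′ : Fin m → Carrier) →
    upperBlock d X Y ⋅ upperBlock d′ X′ Y′ ≋ upperBlock (d * d′) (λ b → X′ b + X b) (λ b → d * Y′ b + Y b)
  upperBlock-⋅ d X Y d′ X′ Y′ =
    ≋-trans (block-⋅ 1# 0# 0# d X Y 0ᵥ 0ᵥ I 1# 0# 0# d′ X′ Y′ 0ᵥ 0ᵥ I)
      (block-cong (+-only₁ (*-identityˡ 1#) (zeroˡ _) (∑-*0 X)) (+-only₃ (zeroʳ _) (zeroˡ _) (∑-*0 X))
                  (+-only₃ (zeroˡ _) (zeroʳ _) (∑-*0 Y)) (+-only₂ (zeroˡ _) refl (∑-*0 Y))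
                  (λ b → +-cong (*-identityˡ _) (trans (+-cong (zeroˡ _) (∑-*-I X b)) (+-identityˡ _)))
                  (λ b → trans (+-cong (zeroˡ _) (+-congˡ (∑-*-I Y b))) (+-identityˡ _))
                  (λ a → +-only₃ (zeroˡ _) (zeroˡ _) (∑-*0 (I a)))
                  (λ a → +-only₃ (zeroˡ _) (zeroˡ _) (∑-*0 (I a)))
                  (λ a b → +-only₃ (zeroˡ _) (zeroˡ _) (∑-*-I (I a) b)))

  upperBlock≋I : ∀ {m} {d} {X Y : Fin m → Carrier} → d ≈ 1# → (∀ b → X b ≈ 0#) → (∀ b → Y b ≈ 0#) → upperBlock d X Y ≋ I
  upperBlock≋I d≈1 X≈0 Y≈0 =
    ≋-trans (block-cong refl refl refl d≈1 X≈0 Y≈0 (λ _ → refl) (λ _ → refl) ≋-refl) (≋-sym I-block)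

module Powers {c ℓ : Level} (S : CommutativeSemiring c ℓ) where
  open CommutativeSemiring S hiding (zero)
  open SemiringExp semiring using (_^_; ^-congʳ; ^-congˡ; ^-assocʳ)
  open Binomial S using (theorem; binomialTerm)
  open SemiringSum semiring using (sum; sum-init-last; sum-cong-≋; sum-replicate-zero)
  open MonoidMult +-monoid using (×-congʳ; ×-congˡ) renaming (_×_ to _×′_)
  open SemiringMult semiring using (×1-homo-*; ×-assoc-*)

  1#^n≈1# : ∀ n → 1# ^ n ≈ 1#
  1#^n≈1# zero = refl
  1#^n≈1# (suc n) = trans (*-identityˡ _) (1#^n≈1# n)

  ×1-homo-^ : ∀ a n → (a ℕ.^ n) ×′ 1# ≈ (a ×′ 1#) ^ n
  ×1-homo-^ a zero = +-identityʳ 1#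
  ×1-homo-^ a (suc n) = trans (×1-homo-* a (a ℕ.^ n)) (*-congˡ (×1-homo-^ a n))

  ×-multiple-of-characteristic : ∀ {p} → p ×′ 1# ≈ 0# → ∀ d x → (d ℕ.* p) ×′ x ≈ 0#
  ×-multiple-of-characteristic {p} p×1≈0 d x = begin
    (d ℕ.* p) ×′ x ≈⟨ ×-congʳ (d ℕ.* p) (*-identityˡ x) ⟨
    (d ℕ.* p) ×′ (1# * x) ≈⟨ ×-assoc-* (d ℕ.* p) 1# x ⟨
    ((d ℕ.* p) ×′ 1#) * x ≈⟨ *-congʳ (×1-homo-* d p) ⟩
    (d ×′ 1#) * (p ×′ 1#) * x ≈⟨ *-congʳ (*-congˡ p×1≈0) ⟩
    (d ×′ 1#) * 0# * x ≈⟨ trans (*-congʳ (zeroʳ _)) (zeroˡ x) ⟩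
    0# ∎
    where open SetoidReasoning setoid

  freshman's-dream : ∀ {p} → Prime p → p ×′ 1# ≈ 0# → ∀ x y → (x + y) ^ p ≈ x ^ p + y ^ p
  freshman's-dream {zero} pp = ⊥-elim (¬prime[0] pp)
  freshman's-dream {suc zero} pp = ⊥-elim (¬prime[1] pp)
  freshman's-dream {p@(suc m@(suc _))} pp p×1≈0 x y = begin
    (x + y) ^ p ≈⟨ theorem p x y ⟩
    t zero + sum (λ k → t (suc k)) ≈⟨ +-congˡ (sum-init-last (λ k → t (suc k))) ⟩
    t zero + (sum (λ j → t (suc (Fin.inject₁ j))) + t (suc (Fin.fromℕ m)))
      ≈⟨ +-cong first (+-cong (trans (sum-cong-≋ middle) (sum-replicate-zero m)) last) ⟩
    y ^ p + (0# + x ^ p) ≈⟨ trans (+-congˡ (+-identityˡ _)) (+-comm _ _) ⟩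
    x ^ p + y ^ p ∎
    where
    open SetoidReasoning setoid
    t : Fin (suc p) → Carrier
    t = binomialTerm x y p
    first : t zero ≈ y ^ p
    first = trans (+-identityʳ _) (*-identityˡ _)
    toℕ-last : Fin.toℕ (Fin.fromℕ p) ≡ p
    toℕ-last = Fin.toℕ-fromℕ p
    last : t (Fin.fromℕ p) ≈ x ^ p
    last = begin
      t (Fin.fromℕ p) ≈⟨ ×-congˡ (≡.trans (≡.cong (p choose_) toℕ-last) (nCn≡1 p)) ⟩
      1 ×′ (x ^ Fin.toℕ (Fin.fromℕ p) * y ^ (p ∸ Fin.toℕ (Fin.fromℕ p))) ≈⟨ +-identityʳ _ ⟩
      x ^ Fin.toℕ (Fin.fromℕ p) * y ^ (p ∸ Fin.toℕ (Fin.fromℕ p))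
        ≈⟨ *-cong (^-congʳ x toℕ-last) (^-congʳ y (≡.trans (≡.cong (p ∸_) toℕ-last) (ℕ.n∸n≡0 p))) ⟩
      x ^ p * 1# ≈⟨ *-identityʳ _ ⟩
      x ^ p ∎
    middle : ∀ j → t (suc (Fin.inject₁ j)) ≈ 0#
    middle j with prime∣binomial pp (s≤s z≤n) (s≤s (≡.subst (ℕ._< m) (≡.sym (Fin.toℕ-inject₁ j)) (Fin.toℕ<n j)))
    ... | Data.Nat.Divisibility.divides d pCk≡d*p = trans (×-congˡ pCk≡d*p) (×-multiple-of-characteristic p×1≈0 d _)

  freshman's-dream-^ : ∀ {p} → Prime p → p ×′ 1# ≈ 0# → ∀ k x y → (x + y) ^ (p ℕ.^ k) ≈ x ^ (p ℕ.^ k) + y ^ (p ℕ.^ k)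
  freshman's-dream-^ pp p×1≈0 zero x y = trans (*-identityʳ _) (+-cong (sym (*-identityʳ _)) (sym (*-identityʳ _)))
  freshman's-dream-^ {p} pp p×1≈0 (suc k) x y = begin
    (x + y) ^ (p ℕ.* p ℕ.^ k) ≈⟨ ^-assocʳ (x + y) p (p ℕ.^ k) ⟨
    ((x + y) ^ p) ^ (p ℕ.^ k) ≈⟨ ^-congˡ (p ℕ.^ k) (freshman's-dream pp p×1≈0 x y) ⟩
    (x ^ p + y ^ p) ^ (p ℕ.^ k) ≈⟨ freshman's-dream-^ pp p×1≈0 k (x ^ p) (y ^ p) ⟩
    (x ^ p) ^ (p ℕ.^ k) + (y ^ p) ^ (p ℕ.^ k) ≈⟨ +-cong (^-assocʳ x p (p ℕ.^ k)) (^-assocʳ y p (p ℕ.^ k)) ⟩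
    x ^ (p ℕ.* p ℕ.^ k) + y ^ (p ℕ.* p ℕ.^ k) ∎
    where open SetoidReasoning setoid

module FieldProperties {c ℓ : Level} (F : CommutativeRing c ℓ) (isField : IsField F) where
  open CommutativeRing F hiding (zero)
  open SemiringExp semiring using (_^_)

  1≉0 : ¬ (1# ≈ 0#)
  1≉0 = proj₁ isField

  inverse : ∀ x → ¬ (x ≈ 0#) → Carrier
  inverse x x≉0 = proj₁ (proj₂ isField x x≉0)

  inverseʳ : ∀ x (x≉0 : ¬ (x ≈ 0#)) → x * inverse x x≉0 ≈ 1#
  inverseʳ x x≉0 = proj₂ (proj₂ isField x x≉0)

  inverseˡ : ∀ x (x≉0 : ¬ (x ≈ 0#)) → inverse x x≉0 * x ≈ 1#
  inverseˡ x x≉0 = trans (*-comm _ _) (inverseʳ x x≉0)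

  *-cancelˡ : ∀ {x y z} → ¬ (x ≈ 0#) → x * y ≈ x * z → y ≈ z
  *-cancelˡ {x} {y} {z} x≉0 xy≈xz = begin
    y ≈⟨ *-identityˡ y ⟨
    1# * y ≈⟨ *-congʳ (inverseˡ x x≉0) ⟨
    inverse x x≉0 * x * y ≈⟨ *-assoc _ _ _ ⟩
    inverse x x≉0 * (x * y) ≈⟨ *-congˡ xy≈xz ⟩
    inverse x x≉0 * (x * z) ≈⟨ *-assoc _ _ _ ⟨
    inverse x x≉0 * x * z ≈⟨ *-congʳ (inverseˡ x x≉0) ⟩
    1# * z ≈⟨ *-identityˡ z ⟩
    z ∎
    where open SetoidReasoning setoid

  x*y≈0⇒y≈0 : ∀ {x y} → ¬ (x ≈ 0#) → x * y ≈ 0# → y ≈ 0#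
  x*y≈0⇒y≈0 x≉0 xy≈0 = *-cancelˡ x≉0 (trans xy≈0 (sym (zeroʳ _)))

  *-nonZero : ∀ {x y} → ¬ (x ≈ 0#) → ¬ (y ≈ 0#) → ¬ (x * y ≈ 0#)
  *-nonZero x≉0 y≉0 xy≈0 = y≉0 (x*y≈0⇒y≈0 x≉0 xy≈0)

  ^-nonZero : ∀ {x} → ¬ (x ≈ 0#) → ∀ n → ¬ (x ^ n ≈ 0#)
  ^-nonZero x≉0 zero = 1≉0
  ^-nonZero x≉0 (suc n) = *-nonZero x≉0 (^-nonZero x≉0 n)

  inverse-unique : ∀ {x y z} → x * y ≈ 1# → x * z ≈ 1# → y ≈ z
  inverse-unique {x} xy≈1 xz≈1 = *-cancelˡ x≉0 (trans xy≈1 (sym xz≈1))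
    where
    x≉0 : ¬ (x ≈ 0#)
    x≉0 x≈0 = 1≉0 (trans (sym xy≈1) (trans (*-congʳ x≈0) (zeroˡ _)))

  inverse-nonZero : ∀ x (x≉0 : ¬ (x ≈ 0#)) → ¬ (inverse x x≉0 ≈ 0#)
  inverse-nonZero x x≉0 x⁻¹≈0 = 1≉0 (trans (sym (inverseʳ x x≉0)) (trans (*-congˡ x⁻¹≈0) (zeroʳ x)))

module EnumeratedSum {c ℓ : Level} (M : CommutativeMonoid c ℓ) where
  open CommutativeMonoid M
  open MonoidSum M using (sum; sum-permute; sum-cong-≋)

  sum-bijection : ∀ {N} (e : Fin N → Carrier) → (∀ i j → e i ≈ e j → i ≡ j) → (∀ x → ∃ λ i → e i ≈ x) →
    (φ ψ : Carrier → Carrier) → (∀ {x y} → x ≈ y → φ x ≈ φ y) → (∀ {x y} → x ≈ y → ψ x ≈ ψ y) →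
    (∀ x → φ (ψ x) ≈ x) → (∀ x → ψ (φ x) ≈ x) →
    (h : Carrier → Carrier) → (∀ {x y} → x ≈ y → h x ≈ h y) →
    sum (λ i → h (e i)) ≈ sum (λ i → h (φ (e i)))
  sum-bijection {N} e e-injective e-surjective φ ψ φ-cong ψ-cong φψ ψφ h h-cong =
    trans (sum-permute (h ∘ e) π) (sum-cong-≋ (λ i → h-cong (proj₂ (e-surjective (φ (e i))))))
    where
    index : Carrier → Fin N
    index x = proj₁ (e-surjective x)
    along : (Carrier → Carrier) → Fin N → Fin N
    along f i = index (f (e i))
    π : Permutation′ N
    π = permutation (along φ) (along ψ)
      (λ i → e-injective _ _ (trans (proj₂ (e-surjective _)) (trans (φ-cong (proj₂ (e-surjective _))) (φψ (e i)))))
      (λ i → e-injective _ _ (trans (proj₂ (e-surjective _)) (trans (ψ-cong (proj₂ (e-surjective _))) (ψφ (e i)))))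

module FiniteField {c ℓ : Level} (F : CommutativeRing c ℓ) (isField : IsField F) {N : ℕ} (card : HasCardinality F N) where
  open CommutativeRing F hiding (zero)
  open FieldProperties F isField
  open RingProperties ring using (+-cancelˡ)
  open SemiringSum semiring using (sum; ∑-distrib-+; sum-replicate)
  open MonoidSum *-commutativeMonoid using (sum-remove; sum-cong-≋)
    renaming (sum to product; ∑-distrib-+ to ∏-distrib-*; sum-replicate to product-replicate)
  open MonoidMult +-monoid using () renaming (_×_ to _×′_)
  open SemiringExp semiring using (_^_)

  private
    e : Fin N → Carrier
    e = proj₁ card
    e-injective : ∀ i j → e i ≈ e j → i ≡ j
    e-injective = proj₁ (proj₂ card)
    e-surjective : ∀ x → ∃ λ i → e i ≈ x
    e-surjective = proj₂ (proj₂ card)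
    index : Carrier → Fin N
    index x = proj₁ (e-surjective x)

  infix 4 _≟_
  _≟_ : Decidable _≈_
  x ≟ y with index x Fin.≟ index y
  ... | yes ix≡iy = yes (trans (sym (proj₂ (e-surjective x))) (trans (reflexive (≡.cong e ix≡iy)) (proj₂ (e-surjective y))))
  ... | no ix≢iy =
    no (λ x≈y → ix≢iy (e-injective _ _ (trans (proj₂ (e-surjective x)) (trans x≈y (sym (proj₂ (e-surjective y)))))))

  ^-zero⇒zero : ∀ {x} n → x ^ suc n ≈ 0# → x ≈ 0#
  ^-zero⇒zero {x} n xⁿ⁺¹≈0 with x ≟ 0#
  ... | yes x≈0 = x≈0
  ... | no x≉0 = ⊥-elim (^-nonZero x≉0 (suc n) xⁿ⁺¹≈0)

  order×1≈0 : N ×′ 1# ≈ 0#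
  order×1≈0 = +-cancelˡ (sum e) _ _ (begin
    sum e + N ×′ 1# ≈⟨ +-congˡ (sum-replicate N) ⟨
    sum e + sum {N} (λ _ → 1#) ≈⟨ ∑-distrib-+ e (λ _ → 1#) ⟨
    sum (λ i → e i + 1#) ≈⟨ translation-invariant ⟨
    sum e ≈⟨ +-identityʳ _ ⟨
    sum e + 0# ∎)
    where
    open SetoidReasoning setoid
    translation-invariant : sum e ≈ sum (λ i → e i + 1#)
    translation-invariant = EnumeratedSum.sum-bijection +-commutativeMonoid e e-injective e-surjective
      (_+ 1#) (_+ - 1#) +-congʳ +-congʳ
      (λ x → trans (+-assoc _ _ _) (trans (+-congˡ (-‿inverseˡ 1#)) (+-identityʳ x)))
      (λ x → trans (+-assoc _ _ _) (trans (+-congˡ (-‿inverseʳ 1#)) (+-identityʳ x)))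
      id id

  zeroToOne : Carrier → Carrier
  zeroToOne a with a ≟ 0#
  ... | yes _ = 1#
  ... | no _ = a

  zeroToOne-nonZero : ∀ a → ¬ (zeroToOne a ≈ 0#)
  zeroToOne-nonZero a with a ≟ 0#
  ... | yes _ = 1≉0
  ... | no a≉0 = a≉0

  zeroToOne-cong : ∀ {a b} → a ≈ b → zeroToOne a ≈ zeroToOne b
  zeroToOne-cong {a} {b} a≈b with a ≟ 0# | b ≟ 0#
  ... | yes _ | yes _ = refl
  ... | yes a≈0 | no b≉0 = ⊥-elim (b≉0 (trans (sym a≈b) a≈0))
  ... | no a≉0 | yes b≈0 = ⊥-elim (a≉0 (trans a≈b b≈0))
  ... | no _ | no _ = a≈b

  product-nonZero : ∀ {n} (f : Fin n → Carrier) → (∀ i → ¬ (f i ≈ 0#)) → ¬ (product f ≈ 0#)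
  product-nonZero {zero} f f≉0 = 1≉0
  product-nonZero {suc n} f f≉0 = *-nonZero (f≉0 zero) (product-nonZero (λ i → f (suc i)) (λ i → f≉0 (suc i)))

  module _ {x : Carrier} (x≉0 : ¬ (x ≈ 0#)) where

    scaleFactor : Carrier → Carrier
    scaleFactor a with a ≟ 0#
    ... | yes _ = 1#
    ... | no _ = x

    zeroToOne-* : ∀ a → zeroToOne (x * a) ≈ scaleFactor a * zeroToOne a
    zeroToOne-* a with a ≟ 0# | x * a ≟ 0#
    ... | yes _ | yes _ = sym (*-identityˡ 1#)
    ... | yes a≈0 | no xa≉0 = ⊥-elim (xa≉0 (trans (*-congˡ a≈0) (zeroʳ x)))
    ... | no a≉0 | yes xa≈0 = ⊥-elim (a≉0 (x*y≈0⇒y≈0 x≉0 xa≈0))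
    ... | no _ | no _ = refl

    product-scaleFactor : ∀ {n} → N ≡ suc n → product (λ i → scaleFactor (e i)) ≈ x ^ n
    product-scaleFactor {n} ≡.refl = begin
      product (λ i → scaleFactor (e i)) ≈⟨ sum-remove {i = index 0#} (λ i → scaleFactor (e i)) ⟩
      scaleFactor (e (index 0#)) * product (λ k → scaleFactor (e (punchIn (index 0#) k)))
        ≈⟨ *-cong at-zero (trans (sum-cong-≋ elsewhere) (product-replicate n)) ⟩
      1# * x ^ n ≈⟨ *-identityˡ _ ⟩
      x ^ n ∎
      where
      open SetoidReasoning setoid
      at-zero : scaleFactor (e (index 0#)) ≈ 1#
      at-zero with e (index 0#) ≟ 0#
      ... | yes _ = refl
      ... | no e≉0 = ⊥-elim (e≉0 (proj₂ (e-surjective 0#)))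
      elsewhere : ∀ k → scaleFactor (e (punchIn (index 0#) k)) ≈ x
      elsewhere k with e (punchIn (index 0#) k) ≟ 0#
      ... | yes e≈0 = ⊥-elim (Fin.punchInᵢ≢i (index 0#) k (e-injective _ _ (trans e≈0 (sym (proj₂ (e-surjective 0#))))))
      ... | no _ = refl

    -- Multiplication by x permutes the field, hence the product of its nonzero elements
    -- (zeroToOne replaces the one zero by 1); comparing the two products gives x ^ (N - 1) ≈ 1.
    fermat-nonZero : ∀ {n} → N ≡ suc n → x ^ n ≈ 1#
    fermat-nonZero {n} N≡1+n = sym (*-cancelˡ (product-nonZero (zeroToOne ∘ e) (zeroToOne-nonZero ∘ e)) (begin
      P * 1# ≈⟨ *-identityʳ P ⟩
      P ≈⟨ EnumeratedSum.sum-bijection *-commutativeMonoid e e-injective e-surjective (x *_) (inverse x x≉0 *_)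
             *-congˡ *-congˡ (cancel (inverseʳ x x≉0)) (cancel (inverseˡ x x≉0)) zeroToOne zeroToOne-cong ⟩
      product (λ i → zeroToOne (x * e i)) ≈⟨ sum-cong-≋ (λ i → zeroToOne-* (e i)) ⟩
      product (λ i → scaleFactor (e i) * zeroToOne (e i)) ≈⟨ ∏-distrib-* (scaleFactor ∘ e) (zeroToOne ∘ e) ⟩
      product (scaleFactor ∘ e) * P ≈⟨ *-congʳ (product-scaleFactor N≡1+n) ⟩
      x ^ n * P ≈⟨ *-comm _ _ ⟩
      P * x ^ n ∎))
      where
      open SetoidReasoning setoid
      P : Carrier
      P = product (zeroToOne ∘ e)
      cancel : ∀ {a b} → a * b ≈ 1# → ∀ y → a * (b * y) ≈ y
      cancel ab≈1 y = trans (sym (*-assoc _ _ _)) (trans (*-congʳ ab≈1) (*-identityˡ y))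

  fermat : ∀ x → x ^ N ≈ x
  fermat x = fermat-at N ≡.refl
    where
    fermat-at : ∀ n → N ≡ n → x ^ n ≈ x
    fermat-at zero N≡0 = ⊥-elim (Fin.¬Fin0 (≡.subst Fin N≡0 (index x)))
    fermat-at (suc n) N≡1+n with x ≟ 0#
    ... | yes x≈0 = trans (*-congʳ x≈0) (trans (zeroˡ _) (sym x≈0))
    ... | no x≉0 = trans (*-congˡ (fermat-nonZero x≉0 N≡1+n)) (*-identityʳ x)

module EntrywiseHomomorphism {c ℓ : Level} (F : CommutativeRing c ℓ)
  (σ : CommutativeRing.Carrier F → CommutativeRing.Carrier F)
  (σ-isRingHomomorphism : RingMorphisms.IsRingHomomorphism (CommutativeRing.rawRing F) (CommutativeRing.rawRing F) σ) where
  open CommutativeRing F hiding (zero)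
  open RingMorphisms.IsRingHomomorphism σ-isRingHomomorphism
  open MatrixAlgebra F

  σ-sum : ∀ {n} (f : Fin n → Carrier) → σ (sum f) ≈ sum (σ ∘ f)
  σ-sum {zero} f = 0#-homo
  σ-sum {suc n} f = trans (+-homo _ _) (+-congˡ (σ-sum (f ∘ suc)))

  σₘ : ∀ {m} → Mat F m → Mat F m
  σₘ A i j = σ (A i j)

  σₘ-cong : ∀ {m} {A B : Mat F m} → A ≋ B → σₘ A ≋ σₘ B
  σₘ-cong A≋B i j = ⟦⟧-cong (A≋B i j)

  σₘ-⋅ : ∀ {m} (A B : Mat F m) → σₘ (A ⋅ B) ≋ σₘ A ⋅ σₘ B
  σₘ-⋅ {m} A B i j = trans (σ-sum (λ k → A i k * B k j)) (sum-cong-≋ {m} (λ k → *-homo _ _))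

  σₘ-· : ∀ {m} (A : Mat F m) (x : Vec' F m) → (λ i → σ ((A · x) i)) ≈v σₘ A · (σ ∘ x)
  σₘ-· {m} A x i = trans (σ-sum (λ k → A i k * x k)) (sum-cong-≋ {m} (λ k → *-homo _ _))

  σ-I : ∀ {m} (i j : Fin m) → σ (I i j) ≈ I i j
  σ-I i j = by-cases (i Fin.≟ j)
    where
    by-cases : Dec (i ≡ j) → σ (I i j) ≈ I i j
    by-cases (yes ≡.refl) = trans (⟦⟧-cong (I-diagonal i)) (trans 1#-homo (sym (I-diagonal i)))
    by-cases (no i≢j) = trans (⟦⟧-cong (I-offDiagonal i≢j)) (trans 0#-homo (sym (I-offDiagonal i≢j)))

  σₘ-I : ∀ {m} → σₘ (I {m}) ≋ I
  σₘ-I = σ-I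

  σₘ-invertible : ∀ {m} {A : Mat F m} → Invertible A → Invertible (σₘ A)
  σₘ-invertible (A⁻¹ , AA⁻¹ , A⁻¹A) =
    σₘ A⁻¹ , ≋-trans (≋-sym (σₘ-⋅ _ _)) (≋-trans (σₘ-cong AA⁻¹) σₘ-I)
           , ≋-trans (≋-sym (σₘ-⋅ _ _)) (≋-trans (σₘ-cong A⁻¹A) σₘ-I)

  -- Entries in the fixed field of σ; for the Frobenius x ↦ x ^ q of GF(q²) this is GF(q).
  Fixed : ∀ {m} → Mat F m → Set ℓ
  Fixed A = σₘ A ≋ A

  FixedVec : ∀ {m} → Vec' F m → Set ℓ
  FixedVec x = ∀ i → σ (x i) ≈ x i

  ⋅-fixed : ∀ {m} {A B : Mat F m} → Fixed A → Fixed B → Fixed (A ⋅ B)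
  ⋅-fixed A-fixed B-fixed = ≋-trans (σₘ-⋅ _ _) (⋅-cong A-fixed B-fixed)

  ᵀ-fixed : ∀ {m} {A : Mat F m} → Fixed A → Fixed (A ᵀ)
  ᵀ-fixed A-fixed i j = A-fixed j i

  ·-fixed : ∀ {m} {A : Mat F m} {x : Vec' F m} → Fixed A → FixedVec x → FixedVec (A · x)
  ·-fixed {A = A} {x} A-fixed x-fixed i = trans (σₘ-· A x i) (·-cong A-fixed x-fixed i)

  inverse-fixed : ∀ {m} {C C⁻¹ : Mat F m} → Fixed C → C ⋅ C⁻¹ ≋ I → C⁻¹ ⋅ C ≋ I → Fixed C⁻¹
  inverse-fixed {C = C} {C⁻¹} C-fixed CC⁻¹ C⁻¹C =
    ≋-sym (left-inverse≋right-inverse C⁻¹C C⋅σC⁻¹≋I)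
    where
    C⋅σC⁻¹≋I : C ⋅ σₘ C⁻¹ ≋ I
    C⋅σC⁻¹≋I = ≋-trans (⋅-congʳ (≋-sym C-fixed)) (≋-trans (≋-sym (σₘ-⋅ C C⁻¹)) (≋-trans (σₘ-cong CC⁻¹) σₘ-I))

  Gram-fixed : ∀ {m} {C K : Mat F m} → Fixed C → Fixed K → Fixed (Gram C K)
  Gram-fixed C-fixed K-fixed = ⋅-fixed (⋅-fixed (ᵀ-fixed C-fixed) K-fixed) C-fixed

  permutationMatrix-fixed : ∀ {m} (π : Fin m → Fin m) → Fixed (permutationMatrix π)
  permutationMatrix-fixed π a b = σ-I a (π b)

  block-fixed : ∀ {m} {a₀₀ a₀₁ a₁₀ a₁₁ : Carrier} {r₀ r₁ c₀ c₁ : Fin m → Carrier} {M : Mat F m} →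
    σ a₀₀ ≈ a₀₀ → σ a₀₁ ≈ a₀₁ → σ a₁₀ ≈ a₁₀ → σ a₁₁ ≈ a₁₁ →
    FixedVec r₀ → FixedVec r₁ → FixedVec c₀ → FixedVec c₁ → Fixed M → Fixed (block a₀₀ a₀₁ a₁₀ a₁₁ r₀ r₁ c₀ c₁ M)
  block-fixed e₀₀ e₀₁ e₁₀ e₁₁ er₀ er₁ ec₀ ec₁ eM zero zero = e₀₀
  block-fixed e₀₀ e₀₁ e₁₀ e₁₁ er₀ er₁ ec₀ ec₁ eM zero (suc zero) = e₀₁
  block-fixed e₀₀ e₀₁ e₁₀ e₁₁ er₀ er₁ ec₀ ec₁ eM (suc zero) zero = e₁₀
  block-fixed e₀₀ e₀₁ e₁₀ e₁₁ er₀ er₁ ec₀ ec₁ eM (suc zero) (suc zero) = e₁₁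
  block-fixed e₀₀ e₀₁ e₁₀ e₁₁ er₀ er₁ ec₀ ec₁ eM zero (suc (suc b)) = er₀ b
  block-fixed e₀₀ e₀₁ e₁₀ e₁₁ er₀ er₁ ec₀ ec₁ eM (suc zero) (suc (suc b)) = er₁ b
  block-fixed e₀₀ e₀₁ e₁₀ e₁₁ er₀ er₁ ec₀ ec₁ eM (suc (suc a)) zero = ec₀ a
  block-fixed e₀₀ e₀₁ e₁₀ e₁₁ er₀ er₁ ec₀ ec₁ eM (suc (suc a)) (suc zero) = ec₁ a
  block-fixed e₀₀ e₀₁ e₁₀ e₁₁ er₀ er₁ ec₀ ec₁ eM (suc (suc a)) (suc (suc b)) = eM a b

  0ᵥ-fixed : ∀ {m} → FixedVec (0ᵥ {m})
  0ᵥ-fixed _ = 0#-homo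

  I₂⊕-fixed : ∀ {m} {D : Mat F m} → Fixed D → Fixed (I₂⊕ D)
  I₂⊕-fixed = block-fixed 1#-homo 0#-homo 0#-homo 1#-homo 0ᵥ-fixed 0ᵥ-fixed 0ᵥ-fixed 0ᵥ-fixed

module SymplecticBasis {c ℓ : Level} (F : CommutativeRing c ℓ) (isField : IsField F)
  (_≟_ : Decidable (CommutativeRing._≈_ F))
  (σ : CommutativeRing.Carrier F → CommutativeRing.Carrier F)
  (σ-isRingHomomorphism : RingMorphisms.IsRingHomomorphism (CommutativeRing.rawRing F) (CommutativeRing.rawRing F) σ) where
  open CommutativeRing F hiding (zero)
  open RingProperties ring using (-0#≈0#; -‿involutive; -‿distribˡ-*; -‿distribʳ-*)
  open RingMorphisms.IsRingHomomorphism σ-isRingHomomorphism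
  open MatrixAlgebra F
  open FieldProperties F isField
  open EntrywiseHomomorphism F σ σ-isRingHomomorphism

  inverse-fixed-scalar : ∀ {κ} (κ≉0 : ¬ (κ ≈ 0#)) → σ κ ≈ κ → σ (inverse κ κ≉0) ≈ inverse κ κ≉0
  inverse-fixed-scalar {κ} κ≉0 σκ≈κ = inverse-unique
    (trans (*-congʳ (sym σκ≈κ)) (trans (sym (*-homo κ _)) (trans (⟦⟧-cong (inverseʳ κ κ≉0)) 1#-homo)))
    (inverseʳ κ κ≉0)

  invertible⇒nonZeroEntry : ∀ {m} {K : Mat F m} → Invertible K → ∀ i → ∃ λ j → ¬ (K i j ≈ 0#)
  invertible⇒nonZeroEntry {m} K-inv i = Fin.¬∀⟶∃¬ m _ (λ j → _ ≟ 0#) (invertible⇒¬zeroRow K-inv 1≉0 i)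

  record Congruent {m} (K L : Mat F m) : Set (c ⊔ ℓ) where
    constructor congruence
    field
      transform : Mat F m
      transform-fixed : Fixed transform
      transform-invertible : Invertible transform
      Gram-transform : Gram transform K ≋ L

  congruent-trans : ∀ {m} {K L M : Mat F m} → Congruent K L → Congruent L M → Congruent K M
  congruent-trans {K = K} (congruence C C-fixed C-inv CK≋L) (congruence D D-fixed D-inv DL≋M) =
    congruence (C ⋅ D) (⋅-fixed C-fixed D-fixed) (⋅-invertible C-inv D-inv)
               (≋-trans (Gram-⋅ C D K) (≋-trans (Gram-cong ≋-refl CK≋L) DL≋M))

  congruent-H⊕ : ∀ {m} {R S : Mat F m} → Congruent R S → Congruent (H⊕ R) (H⊕ S)
  congruent-H⊕ {R = R} (congruence D D-fixed D-inv DR≋S) =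
    congruence (I₂⊕ D) (I₂⊕-fixed D-fixed) (I₂⊕-invertible D-inv)
               (≋-trans (Gram-I₂⊕-H⊕ D R) (⊕-cong refl refl refl refl DR≋S))

  congruent-≋ : ∀ {m} {K L : Mat F m} → K ≋ L → Congruent K L
  congruent-≋ {K = K} K≋L = congruence I σₘ-I (I , ⋅-identityˡ I , ⋅-identityˡ I)
    (≋-trans (⋅-identityʳ (I ᵀ ⋅ K)) (≋-trans (⋅-congʳ I-ᵀ) (≋-trans (⋅-identityˡ K) K≋L)))

  congruent-fixed : ∀ {m} {K L : Mat F m} → Fixed K → Congruent K L → Fixed L
  congruent-fixed K-fixed (congruence C C-fixed _ CK≋L) =
    ≋-trans (σₘ-cong (≋-sym CK≋L)) (≋-trans (Gram-fixed C-fixed K-fixed) CK≋L)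

  congruent-alternating : ∀ {m} {K L : Mat F m} → IsAlternating K → Congruent K L → IsAlternating L
  congruent-alternating {K = K} K-alt (congruence C _ _ CK≋L) =
    (λ i → trans (sym (CK≋L i i)) (proj₁ CK-alt i)) ,
    (λ i j → trans (sym (CK≋L j i)) (trans (proj₂ CK-alt i j) (-‿cong (CK≋L i j))))
    where
    CK-alt : IsAlternating (Gram C K)
    CK-alt = Gram-alternating C K-alt

  congruent-invertible : ∀ {m} {K L : Mat F m} → Invertible K → Congruent K L → Invertible L
  congruent-invertible K-inv (congruence C _ C-inv CK≋L) = invertible-cong CK≋L (Gram-invertible C-inv K-inv)

  H⊕-reflects-fixed : ∀ {m} {R : Mat F m} → Fixed (H⊕ R) → Fixed R
  H⊕-reflects-fixed H⊕cleared-fixed a b = H⊕cleared-fixed (suc (suc a)) (suc (suc b))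

  H⊕-reflects-alternating : ∀ {m} {R : Mat F m} → IsAlternating (H⊕ R) → IsAlternating R
  H⊕-reflects-alternating (diag , anti) = (λ a → diag (suc (suc a))) , (λ a b → anti (suc (suc a)) (suc (suc b)))

  pivot : ∀ {m} {K : Mat F (suc (suc m))} → IsAlternating K → Invertible K →
    ∃ λ K₁ → Congruent K K₁ × ¬ (K₁ zero (suc zero) ≈ 0#)
  pivot {m} {K} (K-diag , _) K-inv with invertible⇒nonZeroEntry {K = K} K-inv zero
  ... | j , K₀ⱼ≉0 = Gram P K , congruence P (permutationMatrix-fixed π) P-invertible ≋-refl , pivot≉0
    where
    j≢0 : j ≢ zero
    j≢0 ≡.refl = K₀ⱼ≉0 (K-diag zero)
    π π⁻¹ : Fin (suc (suc m)) → Fin (suc (suc m))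
    π = swap (suc zero) j
    π⁻¹ = swap j (suc zero)
    P : Mat F (suc (suc m))
    P = permutationMatrix π
    P-invertible : Invertible P
    P-invertible = permutationMatrix π⁻¹ , permutationMatrix-inverse {π = π} {π⁻¹} (λ _ → transpose-inverse (suc zero) j)
                                         , permutationMatrix-inverse {π = π⁻¹} {π} (λ _ → transpose-inverse j (suc zero))
    π0≡0 : π zero ≡ zero
    π0≡0 rewrite dec-false (zero Fin.≟ suc {suc m} zero) (λ ()) | dec-false (zero Fin.≟ j) (j≢0 ∘ ≡.sym) = ≡.refl
    π1≡j : π (suc zero) ≡ j
    π1≡j rewrite dec-true (suc zero Fin.≟ suc {suc m} zero) ≡.refl = ≡.refl
    pivot≉0 : ¬ (Gram P K zero (suc zero) ≈ 0#)
    pivot≉0 P₀₁≈0 = K₀ⱼ≉0 (trans (reflexive (≡.cong₂ K (≡.sym π0≡0) (≡.sym π1≡j)))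
                                 (trans (sym (Gram-permutationMatrix π K zero (suc zero))) P₀₁≈0))

  module ClearPivot {m} {K : Mat F (suc (suc m))} (K-fixed : Fixed K) (K-alt : IsAlternating K)
                    (κ≉0 : ¬ (K zero (suc zero) ≈ 0#)) where
    private
      0F 1F : Fin (suc (suc m))
      0F = zero
      1F = suc zero
      K-diag : ∀ i → K i i ≈ 0#
      K-diag = proj₁ K-alt
      K-anti : ∀ i j → K j i ≈ - K i j
      K-anti = proj₂ K-alt
      κ ι : Carrier
      κ = K 0F 1F
      ι = inverse κ κ≉0
      ικ≈1 : ι * κ ≈ 1#
      ικ≈1 = inverseˡ κ κ≉0
      κι≈1 : κ * ι ≈ 1#
      κι≈1 = inverseʳ κ κ≉0

    X Y : Fin m → Carrier
    X b = - (ι * K (suc (suc b)) 1F)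
    Y b = ι * K (suc (suc b)) 0F

    -- Rescale the second basis vector so that K₀₁ becomes 1 and subtract multiples of the
    -- first two from the others, making them orthogonal to the hyperbolic pair.
    clearing : Mat F (suc (suc m))
    clearing = upperBlock ι X Y

    clearing-fixed : Fixed clearing
    clearing-fixed = block-fixed 1#-homo 0#-homo 0#-homo σι≈ι
      (λ b → trans (-‿homo _) (-‿cong (trans (*-homo _ _) (*-cong σι≈ι (K-fixed _ _)))))
      (λ b → trans (*-homo _ _) (*-cong σι≈ι (K-fixed _ _))) 0ᵥ-fixed 0ᵥ-fixed σₘ-I
      where
      σι≈ι : σ ι ≈ ι
      σι≈ι = inverse-fixed-scalar κ≉0 (K-fixed 0F 1F)

    clearing-invertible : Invertible clearing
    clearing-invertible = upperBlock κ (λ b → - X b) (λ b → - (κ * Y b)) ,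
      ≋-trans (upperBlock-⋅ ι X Y κ _ _)
        (upperBlock≋I ικ≈1 (λ b → -‿inverseˡ (X b))
          (λ b → trans (+-congʳ (trans (sym (-‿distribʳ-* _ _)) (-‿cong (ι*[κ*y]≈y (Y b))))) (-‿inverseˡ (Y b)))) ,
      ≋-trans (upperBlock-⋅ κ _ _ ι X Y) (upperBlock≋I κι≈1 (λ b → -‿inverseʳ (X b)) (λ b → -‿inverseʳ (κ * Y b)))
      where
      ι*[κ*y]≈y : ∀ y → ι * (κ * y) ≈ y
      ι*[κ*y]≈y y = trans (sym (*-assoc _ _ _)) (trans (*-congʳ ικ≈1) (*-identityˡ _))

    private
      G : Mat F (suc (suc m))
      G = Gram clearing K
      G-alt : IsAlternating G
      G-alt = Gram-alternating clearing K-alt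

      row₀ : ∀ l → (clearing ᵀ ⋅ K) 0F l ≈ K 0F l
      row₀ l = +-only₁ (*-identityˡ _) (zeroˡ _) (∑-0* (λ k → K (suc (suc k)) l))

      row₁ : ∀ l → (clearing ᵀ ⋅ K) 1F l ≈ ι * K 1F l
      row₁ l = +-only₂ (zeroˡ _) refl (∑-0* (λ k → K (suc (suc k)) l))

    Gram-clearing₀₁ : G 0F 1F ≈ 1#
    Gram-clearing₀₁ = trans (sum-cong-≋ {suc (suc m)} {y = λ l → K 0F l * clearing l 1F} (λ l → *-congʳ (row₀ l)))
                            (+-only₂ (zeroʳ _) κι≈1 (∑-*0 (λ a → K 0F (suc (suc a)))))

    Gram-clearing₀ : ∀ b → G 0F (suc (suc b)) ≈ 0#
    Gram-clearing₀ b = begin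
      G 0F (suc (suc b)) ≈⟨ sum-cong-≋ {suc (suc m)} {y = λ l → K 0F l * clearing l (suc (suc b))} (λ l → *-congʳ (row₀ l)) ⟩
      K 0F 0F * X b + (κ * Y b + sum (λ a → K 0F (suc (suc a)) * I a b))
        ≈⟨ +-cong (trans (*-congʳ (K-diag 0F)) (zeroˡ _))
                  (+-cong (trans (sym (*-assoc _ _ _)) (trans (*-congʳ κι≈1) (*-identityˡ _)))
                          (∑-*-I (λ a → K 0F (suc (suc a))) b)) ⟩
      0# + (K (suc (suc b)) 0F + K 0F (suc (suc b))) ≈⟨ +-identityˡ _ ⟩
      K (suc (suc b)) 0F + K 0F (suc (suc b)) ≈⟨ +-congʳ (K-anti 0F (suc (suc b))) ⟩
      - K 0F (suc (suc b)) + K 0F (suc (suc b)) ≈⟨ -‿inverseˡ _ ⟩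
      0# ∎
      where open SetoidReasoning setoid

    Gram-clearing₁ : ∀ b → G 1F (suc (suc b)) ≈ 0#
    Gram-clearing₁ b = begin
      G 1F (suc (suc b)) ≈⟨ sum-cong-≋ {suc (suc m)} {y = λ l → ι * K 1F l * clearing l (suc (suc b))} (λ l → *-congʳ (row₁ l)) ⟩
      ι * K 1F 0F * X b + (ι * K 1F 1F * Y b + sum (λ a → ι * K 1F (suc (suc a)) * I a b))
        ≈⟨ +-cong first (+-cong (trans (*-congʳ (trans (*-congˡ (K-diag 1F)) (zeroʳ _))) (zeroˡ _))
                                (∑-*-I (λ a → ι * K 1F (suc (suc a))) b)) ⟩
      ι * Kb₁ + (0# + ι * K 1F (suc (suc b))) ≈⟨ +-congˡ (+-identityˡ _) ⟩
      ι * Kb₁ + ι * K 1F (suc (suc b)) ≈⟨ distribˡ ι _ _ ⟨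
      ι * (Kb₁ + K 1F (suc (suc b))) ≈⟨ *-congˡ (trans (+-congʳ (K-anti 1F (suc (suc b)))) (-‿inverseˡ _)) ⟩
      ι * 0# ≈⟨ zeroʳ ι ⟩
      0# ∎
      where
      open SetoidReasoning setoid
      Kb₁ : Carrier
      Kb₁ = K (suc (suc b)) 1F
      first : ι * K 1F 0F * X b ≈ ι * Kb₁
      first = begin
        ι * K 1F 0F * - (ι * Kb₁) ≈⟨ *-congʳ (*-congˡ (K-anti 0F 1F)) ⟩
        ι * - κ * - (ι * Kb₁) ≈⟨ *-congʳ (-‿distribʳ-* ι κ) ⟨
        - (ι * κ) * - (ι * Kb₁) ≈⟨ -‿distribˡ-* _ _ ⟨
        - (ι * κ * - (ι * Kb₁)) ≈⟨ -‿cong (-‿distribʳ-* _ _) ⟨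
        - - (ι * κ * (ι * Kb₁)) ≈⟨ -‿involutive _ ⟩
        ι * κ * (ι * Kb₁) ≈⟨ trans (*-congʳ ικ≈1) (*-identityˡ _) ⟩
        ι * Kb₁ ∎

    cleared : Mat F m
    cleared a b = G (suc (suc a)) (suc (suc b))

    Gram-clearing≋H⊕ : G ≋ H⊕ cleared
    Gram-clearing≋H⊕ = ≋-trans (block-η G)
      (block-cong (proj₁ G-alt 0F) Gram-clearing₀₁ (trans (proj₂ G-alt 0F 1F) (-‿cong Gram-clearing₀₁)) (proj₁ G-alt 1F)
                  Gram-clearing₀ Gram-clearing₁
                  (λ a → trans (proj₂ G-alt 0F (suc (suc a))) (trans (-‿cong (Gram-clearing₀ a)) -0#≈0#))
                  (λ a → trans (proj₂ G-alt 1F (suc (suc a))) (trans (-‿cong (Gram-clearing₁ a)) -0#≈0#))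
                  (λ a b → refl))

    congruent-H⊕-cleared : Congruent K (H⊕ cleared)
    congruent-H⊕-cleared = congruence clearing clearing-fixed clearing-invertible Gram-clearing≋H⊕

  symplecticBasis : ∀ m {K : Mat F m} → Fixed K → IsAlternating K → Invertible K → Congruent K Ω
  symplecticBasis zero _ _ _ = congruent-≋ (λ ())
  symplecticBasis (suc zero) {K} _ (K-diag , _) K-inv =
    ⊥-elim (invertible⇒¬zeroRow {K = K} K-inv 1≉0 zero λ { zero → K-diag zero })
  symplecticBasis (suc (suc m)) {K} K-fixed K-alt K-inv = congruent-trans K≅H⊕cleared H⊕cleared≅Ω
    where
    K₁ : Mat F (suc (suc m))
    K₁ = proj₁ (pivot {K = K} K-alt K-inv)
    K≅K₁ : Congruent K K₁
    K≅K₁ = proj₁ (proj₂ (pivot {K = K} K-alt K-inv))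
    open ClearPivot (congruent-fixed K-fixed K≅K₁) (congruent-alternating K-alt K≅K₁) (proj₂ (proj₂ (pivot {K = K} K-alt K-inv)))
    K≅H⊕cleared : Congruent K (H⊕ cleared)
    K≅H⊕cleared = congruent-trans K≅K₁ congruent-H⊕-cleared
    cleared-fixed : Fixed cleared
    cleared-fixed = H⊕-reflects-fixed (congruent-fixed K-fixed K≅H⊕cleared)
    cleared-alt : IsAlternating cleared
    cleared-alt = H⊕-reflects-alternating (congruent-alternating K-alt K≅H⊕cleared)
    cleared-inv : Invertible cleared
    cleared-inv = H⊕-reflects-invertible {K = cleared} (congruent-invertible {K = K} K-inv K≅H⊕cleared)
    H⊕cleared≅Ω : Congruent (H⊕ cleared) (H⊕ Ω)
    H⊕cleared≅Ω = congruent-H⊕ (symplecticBasis m cleared-fixed cleared-alt cleared-inv)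

module Frobenius {c ℓ : Level} (F : CommutativeRing c ℓ) (q : ℕ) (gf : IsGF[q²] F q) where
  open CommutativeRing F hiding (zero)
  open SemiringExp semiring using (_^_; ^-congˡ; ^-assocʳ)
  open CommutativeSemiringExp commutativeSemiring using (^-distrib-*)
  open MonoidMult +-monoid using (×-congˡ) renaming (_×_ to _×′_)
  open SemiringMult semiring using (×1-homo-*)
  open RingProperties ring using (x+x≈x⇒x≈0; +-inverseʳ-unique)
  open RingMorphisms rawRing rawRing using (IsRingHomomorphism)
  open Powers commutativeSemiring using (1#^n≈1#; ×1-homo-^; freshman's-dream-^)

  isField : IsField F
  isField = proj₁ (proj₂ gf)

  open FiniteField F isField (proj₂ (proj₂ gf)) public using (_≟_)
  open FiniteField F isField (proj₂ (proj₂ gf)) using (order×1≈0; fermat; ^-zero⇒zero)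

  private
    p k : ℕ
    p = proj₁ (proj₁ gf)
    k = proj₁ (proj₂ (proj₁ gf))
    p-prime : Prime p
    p-prime = proj₁ (proj₂ (proj₂ (proj₁ gf)))
    1≤k : 1 ℕ.≤ k
    1≤k = proj₁ (proj₂ (proj₂ (proj₂ (proj₁ gf))))
    q≡p^k : q ≡ p ℕ.^ k
    q≡p^k = proj₂ (proj₂ (proj₂ (proj₂ (proj₁ gf))))

  q×1≈0 : q ×′ 1# ≈ 0#
  q×1≈0 = ^-zero⇒zero 1 (trans (*-congˡ (*-identityʳ _)) (trans (sym (×1-homo-* q q)) order×1≈0))

  prime×1≈0 : p ×′ 1# ≈ 0#
  prime×1≈0 with k | 1≤k | q≡p^k
  ... | suc k-1 | _ | q≡p^1+k =
    ^-zero⇒zero k-1 (trans (sym (×1-homo-^ p (suc k-1))) (trans (×-congˡ (≡.sym q≡p^1+k)) q×1≈0))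

  frobenius : Carrier → Carrier
  frobenius x = x ^ q

  frobenius-+ : ∀ x y → frobenius (x + y) ≈ frobenius x + frobenius y
  frobenius-+ x y = ≡.subst (λ r → (x + y) ^ r ≈ x ^ r + y ^ r) (≡.sym q≡p^k) (freshman's-dream-^ p-prime prime×1≈0 k x y)

  frobenius-0 : frobenius 0# ≈ 0#
  frobenius-0 = x+x≈x⇒x≈0 _ (trans (sym (frobenius-+ 0# 0#)) (^-congˡ q (+-identityʳ 0#)))

  frobenius-neg : ∀ x → frobenius (- x) ≈ - frobenius x
  frobenius-neg x = +-inverseʳ-unique _ _ (trans (sym (frobenius-+ x (- x))) (trans (^-congˡ q (-‿inverseʳ x)) frobenius-0))

  frobenius-isRingHomomorphism : IsRingHomomorphism frobenius
  frobenius-isRingHomomorphism = record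
    { isSemiringHomomorphism = record
      { isNearSemiringHomomorphism = record
        { +-isMonoidHomomorphism = record
          { isMagmaHomomorphism = record
            { isRelHomomorphism = record { cong = ^-congˡ q }
            ; homo = frobenius-+
            }
          ; ε-homo = frobenius-0
          }
        ; *-homo = λ x y → ^-distrib-* x y q
        }
      ; 1#-homo = 1#^n≈1# q
      }
    ; -‿homo = frobenius-neg
    }

  frobenius-involutive : ∀ x → frobenius (frobenius x) ≈ x
  frobenius-involutive x = trans (^-assocʳ x q q) (fermat x)

module HermitianForms {c ℓ : Level} (F : CommutativeRing c ℓ) (q : ℕ) (gf : IsGF[q²] F q) where
  open CommutativeRing F hiding (zero)
  open MatrixAlgebra F
  open Frobenius F q gf
  open RingMorphisms.IsRingHomomorphism frobenius-isRingHomomorphism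
  open EntrywiseHomomorphism F frobenius frobenius-isRingHomomorphism

  σₘ-involutive : ∀ {m} (A : Mat F m) → σₘ (σₘ A) ≋ A
  σₘ-involutive A i j = frobenius-involutive (A i j)

  hermitianGram : ∀ {m} → Mat F m → Mat F m → Mat F m
  hermitianGram J A = A ᵀ ⋅ J ⋅ σₘ A

  herm-+ˡ : ∀ {m} (J : Mat F m) (x y z : Vec' F m) → herm F q J (λ i → x i + y i) z ≈ herm F q J x z + herm F q J y z
  herm-+ˡ {m} J x y z = begin
    sum (λ i → sum (λ j → (x i + y i) * J i j * frobenius (z j)))
      ≈⟨ sum-cong-≋ {m} (λ i → sum-cong-≋ {m} (λ j → trans (*-congʳ (distribʳ _ _ _)) (distribʳ _ _ _))) ⟩
    sum (λ i → sum (λ j → x i * J i j * frobenius (z j) + y i * J i j * frobenius (z j)))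
      ≈⟨ sum-cong-≋ {m} (λ i → ∑-distrib-+ (λ j → x i * J i j * frobenius (z j)) (λ j → y i * J i j * frobenius (z j))) ⟩
    sum (λ i → sum (λ j → x i * J i j * frobenius (z j)) + sum (λ j → y i * J i j * frobenius (z j)))
      ≈⟨ ∑-distrib-+ (λ i → sum (λ j → x i * J i j * frobenius (z j))) (λ i → sum (λ j → y i * J i j * frobenius (z j))) ⟩
    herm F q J x z + herm F q J y z ∎
    where open SetoidReasoning setoid

  herm-+ʳ : ∀ {m} (J : Mat F m) (x y z : Vec' F m) → herm F q J x (λ i → y i + z i) ≈ herm F q J x y + herm F q J x z
  herm-+ʳ {m} J x y z = begin
    sum (λ i → sum (λ j → x i * J i j * frobenius (y j + z j)))
      ≈⟨ sum-cong-≋ {m} (λ i → sum-cong-≋ {m} (λ j → trans (*-congˡ (+-homo _ _)) (distribˡ _ _ _))) ⟩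
    sum (λ i → sum (λ j → x i * J i j * frobenius (y j) + x i * J i j * frobenius (z j)))
      ≈⟨ sum-cong-≋ {m} (λ i → ∑-distrib-+ (λ j → x i * J i j * frobenius (y j)) (λ j → x i * J i j * frobenius (z j))) ⟩
    sum (λ i → sum (λ j → x i * J i j * frobenius (y j)) + sum (λ j → x i * J i j * frobenius (z j)))
      ≈⟨ ∑-distrib-+ (λ i → sum (λ j → x i * J i j * frobenius (y j))) (λ i → sum (λ j → x i * J i j * frobenius (z j))) ⟩
    herm F q J x y + herm F q J x z ∎
    where open SetoidReasoning setoid

  herm-columns : ∀ {m} (J A : Mat F m) k l → herm F q J (λ i → A i k) (λ i → A i l) ≈ hermitianGram J A k l
  herm-columns {m} J A k l = sym (begin
    sum (λ j → sum (λ i → A i k * J i j) * frobenius (A j l))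
      ≈⟨ sum-cong-≋ {m} (λ j → *-distribʳ-sum (frobenius (A j l)) (λ i → A i k * J i j)) ⟩
    sum (λ j → sum (λ i → A i k * J i j * frobenius (A j l)))
      ≈⟨ ∑-comm (λ j i → A i k * J i j * frobenius (A j l)) ⟩
    sum (λ i → sum (λ j → A i k * J i j * frobenius (A j l))) ∎)
    where open SetoidReasoning setoid

  hermitianGram-cong : ∀ {m} (J : Mat F m) {X Y : Mat F m} → X ≋ Y → hermitianGram J X ≋ hermitianGram J Y
  hermitianGram-cong J X≋Y = ⋅-cong (⋅-congʳ (ᵀ-cong X≋Y)) (σₘ-cong X≋Y)

  hermitianGram-⋅ : ∀ {m} (J X Y : Mat F m) → hermitianGram J (X ⋅ Y) ≋ Y ᵀ ⋅ hermitianGram J X ⋅ σₘ Y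
  hermitianGram-⋅ J X Y = begin
    (X ⋅ Y) ᵀ ⋅ J ⋅ σₘ (X ⋅ Y) ≈⟨ ⋅-cong (⋅-congʳ (ᵀ-anti-homo-⋅ X Y)) (σₘ-⋅ X Y) ⟩
    Y ᵀ ⋅ X ᵀ ⋅ J ⋅ (σₘ X ⋅ σₘ Y) ≈⟨ ⋅-assoc (Y ᵀ ⋅ X ᵀ ⋅ J) (σₘ X) (σₘ Y) ⟨
    Y ᵀ ⋅ X ᵀ ⋅ J ⋅ σₘ X ⋅ σₘ Y ≈⟨ ⋅-congʳ (≋-trans (⋅-congʳ (⋅-assoc (Y ᵀ) (X ᵀ) J)) (⋅-assoc (Y ᵀ) (X ᵀ ⋅ J) (σₘ X))) ⟩
    Y ᵀ ⋅ hermitianGram J X ⋅ σₘ Y ∎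
    where open ≋-Reasoning

  hermitianGram-⋅-fixed : ∀ {m} (J X : Mat F m) {Y : Mat F m} → Fixed Y → hermitianGram J (X ⋅ Y) ≋ Gram Y (hermitianGram J X)
  hermitianGram-⋅-fixed J X {Y} Y-fixed = ≋-trans (hermitianGram-⋅ J X Y) (⋅-congˡ Y-fixed)

  hermitianGram-I : ∀ {m} (J : Mat F m) → hermitianGram J I ≋ J
  hermitianGram-I J = ≋-trans (⋅-cong (⋅-congʳ I-ᵀ) σₘ-I) (≋-trans (⋅-identityʳ (I ⋅ J)) (⋅-identityˡ J))

  hermitianGram-invertible : ∀ {m} {J A : Mat F m} → Invertible J → Invertible A → Invertible (hermitianGram J A)
  hermitianGram-invertible J-inv A-inv = ⋅-invertible (⋅-invertible (ᵀ-invertible A-inv) J-inv) (σₘ-invertible A-inv)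

  hermitianGram-hermitian : ∀ {m} {J : Mat F m} (A : Mat F m) → σₘ J ≋ J ᵀ → σₘ (hermitianGram J A) ≋ hermitianGram J A ᵀ
  hermitianGram-hermitian {J = J} A J-hermitian = begin
    σₘ (A ᵀ ⋅ J ⋅ σₘ A) ≈⟨ ≋-trans (σₘ-⋅ (A ᵀ ⋅ J) (σₘ A)) (⋅-cong (σₘ-⋅ (A ᵀ) J) (σₘ-involutive A)) ⟩
    σₘ A ᵀ ⋅ σₘ J ⋅ A ≈⟨ ⋅-congʳ (⋅-congˡ J-hermitian) ⟩
    σₘ A ᵀ ⋅ J ᵀ ⋅ A ≈⟨ ⋅-assoc (σₘ A ᵀ) (J ᵀ) A ⟩
    σₘ A ᵀ ⋅ (J ᵀ ⋅ A ᵀ ᵀ) ≈⟨ ⋅-congˡ (ᵀ-anti-homo-⋅ (A ᵀ) J) ⟨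
    σₘ A ᵀ ⋅ (A ᵀ ⋅ J) ᵀ ≈⟨ ᵀ-anti-homo-⋅ (A ᵀ ⋅ J) (σₘ A) ⟨
    (A ᵀ ⋅ J ⋅ σₘ A) ᵀ ∎
    where open ≋-Reasoning

module BaerSubgeometries {c ℓ : Level} (F : CommutativeRing c ℓ) (q : ℕ) (gf : IsGF[q²] F q) where
  open CommutativeRing F hiding (zero)
  open RingProperties ring using (-0#≈0#; +-inverseʳ-unique)
  open MatrixAlgebra F
  open Frobenius F q gf
  open FieldProperties F isField
  open RingMorphisms.IsRingHomomorphism frobenius-isRingHomomorphism
  open EntrywiseHomomorphism F frobenius frobenius-isRingHomomorphism
  open HermitianForms F q gf

  ≐-sym : ∀ {m} {S T : PointSet F m} → _≐_ F S T → _≐_ F T S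
  ≐-sym S≐T x = proj₂ (S≐T x) , proj₁ (S≐T x)

  ≐-trans : ∀ {m} {S T U : PointSet F m} → _≐_ F S T → _≐_ F T U → _≐_ F S U
  ≐-trans S≐T T≐U x = proj₁ (T≐U x) ∘ proj₁ (S≐T x) , proj₂ (S≐T x) ∘ proj₂ (T≐U x)

  embedded-≐ : ∀ {m} {J : Mat F m} {S T : PointSet F m} → _≐_ F S T → IsEmbeddedIn F q J S → IsEmbeddedIn F q J T
  embedded-≐ S≐T S-embedded x Tx = S-embedded x (proj₂ (S≐T x) Tx)

  imageUnder-≐ : ∀ {m} (M : Mat F m) {S T : PointSet F m} → _≐_ F S T → _≐_ F (imageUnder F M S) (imageUnder F M T)
  imageUnder-≐ M S≐T x = (λ (y , Sy , x≈My) → y , proj₁ (S≐T y) Sy , x≈My)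
                       , (λ (y , Ty , x≈My) → y , proj₂ (S≐T y) Ty , x≈My)

  canonicalBaerImage-member : ∀ {m} {A : Mat F m} {x v : Vec' F m} → NonZeroVec F v → FixedVec v → x ≈v A · v →
    canonicalBaerImage F q A x
  canonicalBaerImage-member v≉0 v-fixed x≈Av = 1# , _ , 1≉0 , v≉0 , v-fixed , λ i → trans (x≈Av i) (sym (*-identityˡ _))

  canonicalBaerImage-cong : ∀ {m} {A B : Mat F m} → A ≋ B → _≐_ F (canonicalBaerImage F q A) (canonicalBaerImage F q B)
  canonicalBaerImage-cong A≋B x =
    (λ (λ′ , v , λ′≉0 , v≉0 , v-fixed , x≈λAv) →
       λ′ , v , λ′≉0 , v≉0 , v-fixed , λ i → trans (x≈λAv i) (*-congˡ (·-cong A≋B (λ _ → refl) i))) ,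
    (λ (λ′ , v , λ′≉0 , v≉0 , v-fixed , x≈λBv) →
       λ′ , v , λ′≉0 , v≉0 , v-fixed , λ i → trans (x≈λBv i) (*-congˡ (·-cong (≋-sym A≋B) (λ _ → refl) i)))

  imageUnder-canonicalBaerImage : ∀ {m} (M A : Mat F m) →
    _≐_ F (imageUnder F M (canonicalBaerImage F q A)) (canonicalBaerImage F q (M ⋅ A))
  imageUnder-canonicalBaerImage M A x = forward , backward
    where
    forward : imageUnder F M (canonicalBaerImage F q A) x → canonicalBaerImage F q (M ⋅ A) x
    forward (y , (λ′ , v , λ′≉0 , v≉0 , v-fixed , y≈λAv) , x≈My) = λ′ , v , λ′≉0 , v≉0 , v-fixed , λ i → begin
      x i ≈⟨ x≈My i ⟩
      (M · y) i ≈⟨ ·-cong {A = M} ≋-refl y≈λAv i ⟩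
      (M · (λ j → λ′ * (A · v) j)) i ≈⟨ ·-scale M λ′ (A · v) i ⟩
      λ′ * (M · A · v) i ≈⟨ *-congˡ (⋅-·-assoc M A v i) ⟨
      λ′ * ((M ⋅ A) · v) i ∎
      where open SetoidReasoning setoid
    backward : canonicalBaerImage F q (M ⋅ A) x → imageUnder F M (canonicalBaerImage F q A) x
    backward (λ′ , v , λ′≉0 , v≉0 , v-fixed , x≈λMAv) =
      (λ j → λ′ * (A · v) j) , (λ′ , v , λ′≉0 , v≉0 , v-fixed , λ _ → refl) ,
      λ i → trans (x≈λMAv i) (trans (*-congˡ (⋅-·-assoc M A v i)) (sym (·-scale M λ′ (A · v) i)))

  canonicalBaerImage-⋅-fixed : ∀ {m} (A : Mat F m) {C : Mat F m} → Fixed C → Invertible C →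
    _≐_ F (canonicalBaerImage F q (A ⋅ C)) (canonicalBaerImage F q A)
  canonicalBaerImage-⋅-fixed A {C} C-fixed (C⁻¹ , CC⁻¹ , C⁻¹C) x = forward , backward
    where
    forward : canonicalBaerImage F q (A ⋅ C) x → canonicalBaerImage F q A x
    forward (λ′ , v , λ′≉0 , v≉0 , v-fixed , x≈λACv) =
      λ′ , C · v , λ′≉0 , invertible-·-nonZero C⁻¹C v≉0 , ·-fixed C-fixed v-fixed ,
      λ i → trans (x≈λACv i) (*-congˡ (⋅-·-assoc A C v i))
    backward : canonicalBaerImage F q A x → canonicalBaerImage F q (A ⋅ C) x
    backward (λ′ , v , λ′≉0 , v≉0 , v-fixed , x≈λAv) =
      λ′ , C⁻¹ · v , λ′≉0 , invertible-·-nonZero CC⁻¹ v≉0 , ·-fixed (inverse-fixed C-fixed CC⁻¹ C⁻¹C) v-fixed ,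
      λ i → trans (x≈λAv i) (*-congˡ (trans (·-cong {A = A} ≋-refl (λ j → sym (inverse-·-cancel CC⁻¹ v j)) i)
                                            (sym (⋅-·-assoc A C (C⁻¹ · v) i))))

  embedded-alternating : ∀ {m} (J A : Mat F m) → IsEmbeddedIn F q J (canonicalBaerImage F q A) →
    IsAlternating (hermitianGram J A)
  embedded-alternating {m} J A embedded = diagonal , antisymmetric
    where
    K : Mat F m
    K = hermitianGram J A
    column : Fin m → Vec' F m
    column k i = A i k
    unit : Fin m → Vec' F m
    unit k i = I i k
    unit-nonZero : ∀ k → NonZeroVec F (unit k)
    unit-nonZero k unit≈0 = 1≉0 (trans (sym (I-diagonal k)) (unit≈0 k))
    column-member : ∀ k → canonicalBaerImage F q A (column k)
    column-member k = canonicalBaerImage-member (unit-nonZero k) (λ i → σ-I i k) (λ i → sym (∑-*-I (A i) k))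
    diagonal : ∀ k → K k k ≈ 0#
    diagonal k = trans (sym (herm-columns J A k k)) (embedded (column k) (column-member k))
    antisymmetric : ∀ k l → K l k ≈ - K k l
    antisymmetric k l with k Fin.≟ l
    ... | yes ≡.refl = trans (diagonal k) (sym (trans (-‿cong (diagonal k)) -0#≈0#))
    ... | no k≢l = +-inverseʳ-unique _ _ (begin
      K k l + K l k ≈⟨ +-cong (+-identityˡ _) (+-identityʳ _) ⟨
      (0# + K k l) + (K l k + 0#) ≈⟨ +-cong (+-congʳ (diagonal k)) (+-congˡ (diagonal l)) ⟨
      (K k k + K k l) + (K l k + K l l)
        ≈⟨ +-cong (+-cong (herm-columns J A k k) (herm-columns J A k l)) (+-cong (herm-columns J A l k) (herm-columns J A l l)) ⟨
      (herm F q J (column k) (column k) + herm F q J (column k) (column l)) +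
      (herm F q J (column l) (column k) + herm F q J (column l) (column l))
        ≈⟨ +-cong (herm-+ʳ J (column k) (column k) (column l)) (herm-+ʳ J (column l) (column k) (column l)) ⟨
      herm F q J (column k) pair + herm F q J (column l) pair ≈⟨ herm-+ˡ J (column k) (column l) pair ⟨
      herm F q J pair pair ≈⟨ embedded pair pair-member ⟩
      0# ∎)
      where
      open SetoidReasoning setoid
      pair : Vec' F m
      pair i = A i k + A i l
      pair-nonZero : NonZeroVec F (λ i → I i k + I i l)
      pair-nonZero pair≈0 = 1≉0 (trans (sym (trans (+-cong (I-diagonal k) (I-offDiagonal k≢l)) (+-identityʳ _))) (pair≈0 k))
      pair-member : canonicalBaerImage F q A pair
      pair-member = canonicalBaerImage-member pair-nonZero (λ i → trans (+-homo _ _) (+-cong (σ-I i k) (σ-I i l)))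
        (λ i → sym (trans (sum-cong-≋ {m} (λ j → distribˡ (A i j) _ _))
                   (trans (∑-distrib-+ (λ j → A i j * I j k) (λ j → A i j * I j l)) (+-cong (∑-*-I (A i) k) (∑-*-I (A i) l)))))

  open SymplecticBasis F isField _≟_ frobenius frobenius-isRingHomomorphism
    using (Congruent; symplecticBasis; invertible⇒nonZeroEntry)

  SkewFixed : ∀ {m} → Mat F m → Set ℓ
  SkewFixed K = ∀ i j → frobenius (K i j) ≈ - K i j

  hermitian-alternating-skewFixed : ∀ {m} {K : Mat F m} → σₘ K ≋ K ᵀ → IsAlternating K → SkewFixed K
  hermitian-alternating-skewFixed K-hermitian (_ , K-anti) i j = trans (K-hermitian i j) (K-anti i j)

  inverse-∙ₘ-fixed : ∀ {m} {ε} (ε≉0 : ¬ (ε ≈ 0#)) → frobenius ε ≈ - ε → {K : Mat F m} → SkewFixed K →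
    Fixed (inverse ε ε≉0 ∙ₘ K)
  inverse-∙ₘ-fixed {ε = ε} ε≉0 σε≈-ε {K} K-skew a b = begin
    frobenius (ι * K a b) ≈⟨ *-homo ι (K a b) ⟩
    frobenius ι * frobenius (K a b) ≈⟨ *-cong σι≈-ι (K-skew a b) ⟩
    - ι * - K a b ≈⟨ -x*-y≈x*y ι (K a b) ⟩
    ι * K a b ∎
    where
    open SetoidReasoning setoid
    open RingProperties ring using (-‿distribˡ-*; -‿distribʳ-*; -‿involutive)
    -x*-y≈x*y : ∀ x y → - x * - y ≈ x * y
    -x*-y≈x*y x y = trans (sym (-‿distribˡ-* x (- y))) (trans (-‿cong (sym (-‿distribʳ-* x y))) (-‿involutive _))
    ι : Carrier
    ι = inverse ε ε≉0
    σι≈-ι : frobenius ι ≈ - ι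
    σι≈-ι = inverse-unique {x = frobenius ε}
      (trans (sym (*-homo ε ι)) (trans (⟦⟧-cong (inverseʳ ε ε≉0)) 1#-homo))
      (trans (*-congʳ σε≈-ε) (trans (-x*-y≈x*y ε ι) (inverseʳ ε ε≉0)))

  record EqualizedFrames {m} (J A A′ : Mat F m) : Set (c ⊔ ℓ) where
    field
      {C C′} : Mat F m
      C-fixed : Fixed C
      C-invertible : Invertible C
      C′-fixed : Fixed C′
      C′-invertible : Invertible C′
      frames-equal : hermitianGram J (A ⋅ C) ≋ hermitianGram J (A′ ⋅ C′)

  module _ {m} {J : Mat F m} (J-nondegenerate : IsNondegHermitian F q J) where
    private
      J-hermitian : σₘ J ≋ J ᵀ
      J-hermitian = proj₁ J-nondegenerate
      J-invertible : Invertible J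
      J-invertible = proj₂ J-nondegenerate

    unitary-transporter : ∀ {G G′ : Mat F m} → Invertible G → Invertible G′ → hermitianGram J G ≋ hermitianGram J G′ →
      ∃ λ M → IsUnitary F q J M × M ⋅ G ≋ G′
    unitary-transporter {G} {G′} (G⁻¹ , GG⁻¹ , G⁻¹G) G′-invertible G≈G′ =
      G′ ⋅ G⁻¹ , (⋅-invertible G′-invertible (G , G⁻¹G , GG⁻¹) , unitary) , transports
      where
      open ≋-Reasoning
      unitary : hermitianGram J (G′ ⋅ G⁻¹) ≋ J
      unitary = begin
        hermitianGram J (G′ ⋅ G⁻¹) ≈⟨ hermitianGram-⋅ J G′ G⁻¹ ⟩
        G⁻¹ ᵀ ⋅ hermitianGram J G′ ⋅ σₘ G⁻¹ ≈⟨ ⋅-congʳ (⋅-congˡ G≈G′) ⟨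
        G⁻¹ ᵀ ⋅ hermitianGram J G ⋅ σₘ G⁻¹ ≈⟨ hermitianGram-⋅ J G G⁻¹ ⟨
        hermitianGram J (G ⋅ G⁻¹) ≈⟨ hermitianGram-cong J GG⁻¹ ⟩
        hermitianGram J I ≈⟨ hermitianGram-I J ⟩
        J ∎
      transports : G′ ⋅ G⁻¹ ⋅ G ≋ G′
      transports = begin
        G′ ⋅ G⁻¹ ⋅ G ≈⟨ ⋅-assoc G′ G⁻¹ G ⟩
        G′ ⋅ (G⁻¹ ⋅ G) ≈⟨ ⋅-congˡ G⁻¹G ⟩
        G′ ⋅ I ≈⟨ ⋅-identityʳ G′ ⟩
        G′ ∎

    skewFixed-normalizable : ∀ {ε} (ε≉0 : ¬ (ε ≈ 0#)) → frobenius ε ≈ - ε → ∀ {L : Mat F m} →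
      Invertible L → IsAlternating L → SkewFixed L → Congruent (inverse ε ε≉0 ∙ₘ L) Ω
    skewFixed-normalizable {ε} ε≉0 σε≈-ε {L} L-invertible L-alt L-skew =
      symplecticBasis m (inverse-∙ₘ-fixed ε≉0 σε≈-ε L-skew) (∙ₘ-alternating (inverse ε ε≉0) L-alt)
                      (∙ₘ-invertible {K = L} (inverseˡ ε ε≉0) L-invertible)

    frame-hermitianGram : ∀ {A : Mat F m} → Invertible A → IsEmbeddedIn F q J (canonicalBaerImage F q A) →
      Invertible (hermitianGram J A) × IsAlternating (hermitianGram J A) × SkewFixed (hermitianGram J A)
    frame-hermitianGram {A} A-invertible A-embedded =
      hermitianGram-invertible {A = A} J-invertible A-invertible , K-alt ,
      hermitian-alternating-skewFixed (hermitianGram-hermitian A J-hermitian) K-alt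
      where
      K-alt : IsAlternating (hermitianGram J A)
      K-alt = embedded-alternating J A A-embedded

    -- An entry ε of the skew-fixed K satisfies ε ^ q ≈ - ε, so ε⁻¹ K and ε⁻¹ K′ are alternating over
    -- GF(q) and both congruent to Ω there; dividing by the common ε again equalizes K and K′.
    equalizing-frames : Fin m → ∀ {A A′ : Mat F m} →
      Invertible A → IsEmbeddedIn F q J (canonicalBaerImage F q A) →
      Invertible A′ → IsEmbeddedIn F q J (canonicalBaerImage F q A′) →
      EqualizedFrames J A A′
    equalizing-frames i₀ {A} {A′} A-invertible A-embedded A′-invertible A′-embedded =
      record { C-fixed = C-fixed ; C-invertible = C-invertible ; C′-fixed = C′-fixed ; C′-invertible = C′-invertible
             ; frames-equal = frames-equal }
      where
      K K′ : Mat F m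
      K = hermitianGram J A
      K′ = hermitianGram J A′
      K-frame : Invertible K × IsAlternating K × SkewFixed K
      K-frame = frame-hermitianGram A-invertible A-embedded
      K′-frame : Invertible K′ × IsAlternating K′ × SkewFixed K′
      K′-frame = frame-hermitianGram A′-invertible A′-embedded
      pivot : ∃ λ j → ¬ (K i₀ j ≈ 0#)
      pivot = invertible⇒nonZeroEntry {K = K} (proj₁ K-frame) i₀
      ε : Carrier
      ε = K i₀ (proj₁ pivot)
      ε≉0 : ¬ (ε ≈ 0#)
      ε≉0 = proj₂ pivot
      ι : Carrier
      ι = inverse ε ε≉0
      normalized : ∀ {L : Mat F m} → Invertible L × IsAlternating L × SkewFixed L → Congruent (ι ∙ₘ L) Ω
      normalized (L-invertible , L-alt , L-skew) =
        skewFixed-normalizable ε≉0 (proj₂ (proj₂ K-frame) i₀ (proj₁ pivot)) L-invertible L-alt L-skew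
      open Congruent (normalized K-frame)
        renaming (transform to C; transform-fixed to C-fixed; transform-invertible to C-invertible; Gram-transform to C-Ω)
      open Congruent (normalized K′-frame)
        renaming (transform to C′; transform-fixed to C′-fixed; transform-invertible to C′-invertible; Gram-transform to C′-Ω)
      Gram-equal : Gram C K ≋ Gram C′ K′
      Gram-equal a b = *-cancelˡ (inverse-nonZero ε ε≉0) (begin
        ι * Gram C K a b ≈⟨ Gram-∙ₘ ι C K a b ⟨
        Gram C (ι ∙ₘ K) a b ≈⟨ C-Ω a b ⟩
        Ω a b ≈⟨ C′-Ω a b ⟨
        Gram C′ (ι ∙ₘ K′) a b ≈⟨ Gram-∙ₘ ι C′ K′ a b ⟩
        ι * Gram C′ K′ a b ∎)
        where open SetoidReasoning setoid
      frames-equal : hermitianGram J (A ⋅ C) ≋ hermitianGram J (A′ ⋅ C′)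
      frames-equal = ≋-trans (hermitianGram-⋅-fixed J A C-fixed) (≋-trans Gram-equal (≋-sym (hermitianGram-⋅-fixed J A′ C′-fixed)))

    transport-frames : ∀ {A A′ : Mat F m} {S T : PointSet F m} → Invertible A → Invertible A′ →
      _≐_ F S (canonicalBaerImage F q A) → _≐_ F T (canonicalBaerImage F q A′) → EqualizedFrames J A A′ →
      ∃ λ (M : Mat F m) → IsUnitary F q J M × _≐_ F (imageUnder F M S) T
    transport-frames {A} {A′} {S} {T} A-invertible A′-invertible S≐A T≐A′ frames = M , M-unitary , image
      where
      open EqualizedFrames frames
      transporter : ∃ λ M → IsUnitary F q J M × M ⋅ (A ⋅ C) ≋ A′ ⋅ C′
      transporter = unitary-transporter {A ⋅ C} {A′ ⋅ C′}
        (⋅-invertible {A = A} {C} A-invertible C-invertible) (⋅-invertible {A = A′} {C′} A′-invertible C′-invertible) frames-equal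
      M : Mat F m
      M = proj₁ transporter
      M-unitary : IsUnitary F q J M
      M-unitary = proj₁ (proj₂ transporter)
      S≐AC : _≐_ F S (canonicalBaerImage F q (A ⋅ C))
      S≐AC = ≐-trans S≐A (≐-sym (canonicalBaerImage-⋅-fixed A C-fixed C-invertible))
      image : _≐_ F (imageUnder F M S) T
      image = ≐-trans (imageUnder-≐ M S≐AC)
             (≐-trans (imageUnder-canonicalBaerImage M (A ⋅ C))
             (≐-trans (canonicalBaerImage-cong (proj₂ (proj₂ transporter)))
             (≐-trans (canonicalBaerImage-⋅-fixed A′ C′-fixed C′-invertible) (≐-sym T≐A′))))

open import Data.Nat using (_≤_; _*_)

mainTheorem11 : ∀ {c ℓ : Level} (F : CommutativeRing c ℓ) (q : ℕ) → IsGF[q²] F q →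
    (n : ℕ) → 1 ≤ n →
    (J : Mat F (2 * n)) → IsNondegHermitian F q J →
    (S T : PointSet F (2 * n)) →
    IsBaerSubgeometry F q S → IsEmbeddedIn F q J S →
    IsBaerSubgeometry F q T → IsEmbeddedIn F q J T →
    ∃ λ (M : Mat F (2 * n)) → IsUnitary F q J M × _≐_ F (imageUnder F M S) T
mainTheorem11 F q gf (suc n) _ J J-nondegenerate S T (A , A-invertible , S≐A) S-embedded (A′ , A′-invertible , T≐A′) T-embedded =
  transport-frames {J = J} J-nondegenerate {A} {A′} {S} {T} A-invertible A′-invertible S≐A T≐A′ frames
  where
  open BaerSubgeometries F q gf
  frames : EqualizedFrames J A A′
  frames = equalizing-frames {J = J} J-nondegenerate zero {A} {A′}
    A-invertible (embedded-≐ {J = J} S≐A S-embedded) A′-invertible (embedded-≐ {J = J} T≐A′ T-embedded)
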